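{- Let $\ell\ge1$, $k=2^\ell$, $m\ge1$, and let $X_1,\dots,X_k$ be weighted graphs each on $m$ vertices. Suppose that for each $j$ there is an invertible $m\times m$ weak Hadamard matrix $S_j$ with pairwise orthogonal columns, first column $\mathbf{1}_m$, all other columns orthogonal to $\mathbf{1}_m$, and $S_j^{ -1}L(X_j)S_j$ diagonal. Let $X=\bigsqcup_{j=1}^kX_j$ with vertices ordered copy by copy. Define $Q=\begin{bmatrix}1&1\\1&-1\end{bmatrix}\otimes \mathbf{1}_m$ if $\ell=1$ and $Q=P_{\ell-1}\otimes\mathbf{1}_m$ if $\ell\ge2$, where $$P_1=\begin{bmatrix}1&1&1&0\\1&-1&1&0\\1&0&-1&1\\1&0&-1&-1\end{bmatrix},\qquad P_i=\begin{bmatrix}P_{i-1}&P_{i-1}\\P_{i-1}&-P_{i-1}\end{bmatrix}\ (i\ge2).$$ Then $X$ is WHD, and $L(X)$ is diagonalized by the matrix $\big[\,Q\ \big|\ \bigoplus_{j=1}^k S_j[1]\,\big]$, which is a weak Hadamard matrix with pairwise orthogonal columns.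
   Context: Graphs are finite, simple, undirected, edge-weighted; $L(X)$ is the Laplacian (weighted degree matrix minus weighted adjacency matrix). $\mathbf{1}_m$ is the all-ones vector (viewed as an $m\times1$ matrix), $M[1]$ is $M$ with its first column deleted, $\bigoplus$ is block-diagonal direct sum, $\bigsqcup$ is disjoint union. A weak Hadamard matrix is a real square matrix with entries in $\{ -1,0,1\}$ whose Gram matrix $P^TP$ is tridiagonal; a graph is WHD if some invertible weak Hadamard matrix conjugates its Laplacian to a diagonal matrix. -}

module Defs where

open import Level using (Level; _⊔_) renaming (suc to lsuc)
open import Data.Nat as ℕ using (ℕ; zero; suc; _^_)
import Data.Nat.Properties
open import Data.Nat.Properties using (*-suc)
open import Data.Integer as ℤ using (ℤ; +_; -[1+_]; 0ℤ; 1ℤ; -1ℤ)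
open import Data.Fin as Fin using (Fin; zero; suc; toℕ; splitAt; remQuot; cast)
open import Data.Sum using (_⊎_; inj₁; inj₂)
open import Data.Product using (Σ; _×_; _,_; proj₁; proj₂; ∃)
open import Relation.Nullary using (¬_; yes; no)
open import Relation.Binary.PropositionalEquality using (_≡_; refl; sym; trans; cong)
open import Algebra.Bundles using (CommutativeRing)

Mat : ∀ {a} → Set a → ℕ → ℕ → Set a
Mat A m n = Fin m → Fin n → A

sumWith : ∀ {a} {A : Set a} → (A → A → A) → A → {n : ℕ} → (Fin n → A) → A
sumWith _+_ e {zero}  f = e
sumWith _+_ e {suc n} f = f zero + sumWith _+_ e (λ i → f (suc i))

sumℤ : {n : ℕ} → (Fin n → ℤ) → ℤ
sumℤ = sumWith ℤ._+_ 0ℤ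

gramℤ : ∀ {m n} → Mat ℤ m n → Mat ℤ n n
gramℤ M i j = sumℤ (λ r → M r i ℤ.* M r j)

data Trit : ℤ → Set where
  t-1 : Trit -1ℤ
  t0  : Trit 0ℤ
  t1  : Trit 1ℤ

WeakHadamard : ∀ {n} → Mat ℤ n n → Set
WeakHadamard {n} M =
  (∀ i j → Trit (M i j)) ×
  (∀ (i j : Fin n) → (suc (toℕ i) ℕ.< toℕ j ⊎ suc (toℕ j) ℕ.< toℕ i) → gramℤ M i j ≡ 0ℤ)

OrthogonalColumns : ∀ {m n} → Mat ℤ m n → Set
OrthogonalColumns M = ∀ i j → ¬ (i ≡ j) → gramℤ M i j ≡ 0ℤ

module RingStuff {c ℓ} (R : CommutativeRing c ℓ) where
  open CommutativeRing R

  ιℕ : ℕ → Carrier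
  ιℕ zero    = 0#
  ιℕ (suc n) = 1# + ιℕ n

  ι : ℤ → Carrier
  ι (+ n)      = ιℕ n
  ι -[1+ n ]   = - ιℕ (suc n)

record Char0Field c ℓ : Set (lsuc (c ⊔ ℓ)) where
  field
    commutativeRing : CommutativeRing c ℓ
  open CommutativeRing commutativeRing public
  open RingStuff commutativeRing public
  field
    inverse : ∀ x → ¬ (x ≈ 0#) → Σ Carrier (λ y → x * y ≈ 1#)
    char0   : ∀ n → ¬ (ιℕ (suc n) ≈ 0#)

module OverField {c ℓ} (F : Char0Field c ℓ) where
  open Char0Field F

  MatF : ℕ → ℕ → Set c
  MatF = Mat Carrier

  sumF : {n : ℕ} → (Fin n → Carrier) → Carrier
  sumF = sumWith _+_ 0#

  _⊛_ : ∀ {m n p} → MatF m n → MatF n p → MatF m p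
  (A ⊛ B) i k = sumF (λ j → A i j * B j k)

  idM : ∀ {n} → MatF n n
  idM i j with i Fin.≟ j
  ... | yes _ = 1#
  ... | no  _ = 0#

  _≈M_ : ∀ {m n} → MatF m n → MatF m n → Set ℓ
  A ≈M B = ∀ i j → A i j ≈ B i j

  IsDiagonal : ∀ {n} → MatF n n → Set ℓ
  IsDiagonal D = ∀ i j → ¬ (i ≡ j) → D i j ≈ 0#

  embed : ∀ {m n} → Mat ℤ m n → MatF m n
  embed M i j = ι (M i j)

  IsInverse : ∀ {n} → MatF n n → MatF n n → Set ℓ
  IsInverse P Pinv = ((Pinv ⊛ P) ≈M idM) × ((P ⊛ Pinv) ≈M idM)

  Diagonalizes : ∀ {n} → MatF n n → MatF n n → Set (c ⊔ ℓ)
  Diagonalizes {n} P L = Σ (MatF n n) (λ Pinv → IsInverse P Pinv × IsDiagonal ((Pinv ⊛ L) ⊛ P))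

  -- Weighted graphs on Fin m: symmetric weight function, zero on the
  -- diagonal (no loops); non-edges have weight 0.

  record WGraph (m : ℕ) : Set (c ⊔ ℓ) where
    field
      w     : Fin m → Fin m → Carrier
      symm  : ∀ i j → w i j ≈ w j i
      loopless : ∀ i → w i i ≈ 0#
  open WGraph public

  laplacianW : ∀ {m} → (Fin m → Fin m → Carrier) → MatF m m
  laplacianW W i j with i Fin.≟ j
  ... | yes _ = sumF (λ k → W i k)
  ... | no  _ = - W i j

  laplacian : ∀ {m} → WGraph m → MatF m m
  laplacian X = laplacianW (w X)

  -- disjoint union of k graphs on m vertices; vertex (j , a) of the
  -- j-th copy is Fin.combine j a (vertices ordered copy by copy)
  unionW : ∀ {k m} → (Fin k → WGraph m) → Fin (k ℕ.* m) → Fin (k ℕ.* m) → Carrier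
  unionW {k} {m} Xs p q with remQuot {k} m p | remQuot {k} m q
  ... | (j , a) | (j' , b) with j Fin.≟ j'
  ...   | yes _ = w (Xs j) a b
  ...   | no  _ = 0#

  WHDLap : ∀ {n} → MatF n n → Set (c ⊔ ℓ)
  WHDLap {n} L = Σ (Mat ℤ n n) (λ P → WeakHadamard P × Diagonalizes (embed P) L)

  IsWHD : ∀ {m} → WGraph m → Set (c ⊔ ℓ)
  IsWHD X = WHDLap (laplacian X)

doubleM : ∀ {n} → Mat ℤ n n → Mat ℤ (n ℕ.+ n) (n ℕ.+ n)
doubleM {n} A p q with splitAt n p | splitAt n q
... | inj₁ i | inj₁ j = A i j
... | inj₁ i | inj₂ j = A i j
... | inj₂ i | inj₁ j = A i j
... | inj₂ i | inj₂ j = ℤ.- A i j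

-- size of P_(i+1)
dimP : ℕ → ℕ
dimP zero    = 4
dimP (suc i) = dimP i ℕ.+ dimP i

P1 : Mat ℤ 4 4
P1 zero                   = λ { zero → 1ℤ ; (suc zero) → 1ℤ ; (suc (suc zero)) → 1ℤ ; (suc (suc (suc zero))) → 0ℤ }
P1 (suc zero)             = λ { zero → 1ℤ ; (suc zero) → -1ℤ ; (suc (suc zero)) → 1ℤ ; (suc (suc (suc zero))) → 0ℤ }
P1 (suc (suc zero))       = λ { zero → 1ℤ ; (suc zero) → 0ℤ ; (suc (suc zero)) → -1ℤ ; (suc (suc (suc zero))) → 1ℤ }
P1 (suc (suc (suc zero))) = λ { zero → 1ℤ ; (suc zero) → 0ℤ ; (suc (suc zero)) → -1ℤ ; (suc (suc (suc zero))) → -1ℤ }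

-- Pmat i = P_(i+1)
Pmat : (i : ℕ) → Mat ℤ (dimP i) (dimP i)
Pmat zero    = P1
Pmat (suc i) = doubleM (Pmat i)

dimP≡ : ∀ i → dimP i ≡ 2 ^ (suc (suc i))
dimP≡ zero    = refl
dimP≡ (suc i) rewrite dimP≡ i = cong (λ x → 2 ^ suc (suc i) ℕ.+ x) (sym (Data.Nat.Properties.+-identityʳ (2 ^ suc (suc i))))

castM : ∀ {m n m' n'} → m ≡ m' → n ≡ n' → Mat ℤ m n → Mat ℤ m' n'
castM e e' A i j = A (cast (sym e) i) (cast (sym e') j)

H2 : Mat ℤ 2 2
H2 zero       = λ { zero → 1ℤ ; (suc zero) → 1ℤ }
H2 (suc zero) = λ { zero → 1ℤ ; (suc zero) → -1ℤ }

-- base of Q: [1 1; 1 -1] for ℓ = 1, P_(ℓ-1) for ℓ ≥ 2 (ℓ = 0 is never used)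
Qbase : (ℓ : ℕ) → Mat ℤ (2 ^ ℓ) (2 ^ ℓ)
Qbase zero          = λ _ _ → 1ℤ
Qbase (suc zero)    = H2
Qbase (suc (suc i)) = castM (dimP≡ i) (dimP≡ i) (Pmat i)

-- A ⊗ 1_m (rows ordered copy by copy)
kron1 : ∀ {k k'} (m : ℕ) → Mat ℤ k k' → Mat ℤ (k ℕ.* m) k'
kron1 {k} m A p c = A (proj₁ (remQuot {k} m p)) c

Qmat : (ℓ m : ℕ) → Mat ℤ (2 ^ ℓ ℕ.* m) (2 ^ ℓ)
Qmat ℓ m = kron1 m (Qbase ℓ)

dropFirstCol : ∀ {m n} → Mat ℤ m (suc n) → Mat ℤ m n
dropFirstCol M i j = M i (suc j)

directSum : ∀ {k m n} → (Fin k → Mat ℤ m n) → Mat ℤ (k ℕ.* m) (k ℕ.* n)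
directSum {k} {m} {n} As p q with remQuot {k} m p | remQuot {k} n q
... | (j , a) | (j' , b) with j Fin.≟ j'
...   | yes _ = As j a b
...   | no  _ = 0ℤ

hcat : ∀ {m n n'} → Mat ℤ m n → Mat ℤ m n' → Mat ℤ m (n ℕ.+ n')
hcat {n = n} A B i q with splitAt n q
... | inj₁ j = A i j
... | inj₂ j = B i j

-- [ Q | ⊕_j S_j[1] ], with m = suc n; it has k + k*n = k*(n+1) columns
bigT : (ℓ n : ℕ) → (Fin (2 ^ ℓ) → Mat ℤ (suc n) (suc n)) → Mat ℤ (2 ^ ℓ ℕ.* suc n) (2 ^ ℓ ℕ.* suc n)
bigT ℓ n S = castM refl (sym (*-suc (2 ^ ℓ) n))
               (hcat (Qmat ℓ (suc n)) (directSum (λ j → dropFirstCol (S j))))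

-- T = [ Q ⊗ 1ₘ | ⊕ⱼ Sⱼ[1] ] has entries in {-1, 0, 1} and orthogonal columns: the columns
-- of Q ⊗ 1ₘ are orthogonal because those of Q are; they are constant on each copy, while the
-- columns of Sⱼ[1] sum to zero; and columns of different Sⱼ[1] live on different copies.
-- Q arises from [1 1; 1 -1] or P₁ by repeated doubling A ↦ [A A; A -A], which doubles Gram
-- matrices and integer scaled inverses (B A = A B = s I), so Q has orthogonal columns and is
-- invertible in characteristic 0.  Every column of T is an eigenvector of L(X) = ⊕ⱼ L(Xⱼ):
-- the columns of Q ⊗ 1ₘ with eigenvalue 0, since the rows of a Laplacian sum to zero, and the
-- columns of Sⱼ[1] with the eigenvalues of L(Xⱼ).  With an explicit two-sided inverse of T,
-- T⁻¹ L(X) T is therefore diagonal.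

module Submission where

open import Defs
open import Algebra.Bundles using (CommutativeRing)
open import Data.Nat as ℕ using (ℕ; zero; suc; _^_; _≤_)
open import Data.Integer as ℤ using (ℤ; +_; -[1+_]; 0ℤ; 1ℤ; _⊖_)
import Data.Integer.Properties as ℤ
import Data.Nat.Properties as ℕ
open import Data.Fin as Fin using (Fin; zero; suc; _↑ˡ_; _↑ʳ_; cast; combine; remQuot; splitAt; join; punchIn)
import Data.Fin.Properties as Fin
open import Data.Vec.Functional using (Vector; foldr)
open import Data.Product using (Σ; _×_; _,_; proj₁; proj₂; uncurry)
open import Data.Sum using (_⊎_; inj₁; inj₂; [_,_]′)
open import Data.Sum.Properties using (inj₁-injective; inj₂-injective)
open import Function using (_∘_)
open import Data.Empty using (⊥; ⊥-elim)
open import Relation.Nullary using (Dec; yes; no)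
open import Relation.Nullary.Decidable using (True; toWitness; ¬?; _→-dec_)
open import Relation.Binary.PropositionalEquality as ≡ using (_≡_; _≢_; refl)

sumWith≡foldr : ∀ {a} {A : Set a} (_∙_ : A → A → A) (ε : A) {n} (f : Fin n → A) →
                sumWith _∙_ ε f ≡ foldr _∙_ ε f
sumWith≡foldr _∙_ ε {zero}  f = refl
sumWith≡foldr _∙_ ε {suc n} f = ≡.cong (f zero ∙_) (sumWith≡foldr _∙_ ε (f ∘ suc))

data Split (m n : ℕ) : Fin (m ℕ.+ n) → Set where
  inl : ∀ i → Split m n (i ↑ˡ n)
  inr : ∀ j → Split m n (m ↑ʳ j)

splitOf : ∀ m n x → Split m n x
splitOf m n x = ≡.subst (Split m n) (Fin.join-splitAt m n x) (view (splitAt m x))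
  where
  view : ∀ s → Split m n (join m n s)
  view (inj₁ i) = inl i
  view (inj₂ j) = inr j

↑ˡ≢↑ʳ : ∀ {m n} (i : Fin m) (j : Fin n) → i ↑ˡ n ≢ m ↑ʳ j
↑ˡ≢↑ʳ {m} {n} i j eq with ≡.trans (≡.sym (Fin.splitAt-↑ˡ m i n)) (≡.trans (≡.cong (splitAt m) eq) (Fin.splitAt-↑ʳ m n j))
... | ()

infix 10 _ᵀ
_ᵀ : ∀ {a} {A : Set a} {m n} → Mat A m n → Mat A n m
(M ᵀ) i j = M j i

data Block (k m : ℕ) : Fin (k ℕ.* m) → Set where
  block : ∀ j a → Block k m (combine {k} j a)

blockOf : ∀ k m p → Block k m p
blockOf k m p = ≡.subst (Block k m) (Fin.combine-remQuot {k} m p) (block _ _)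

module _ {a} {A : Set a} {k m n : ℕ} (z : A) (As : Fin k → Mat A m n) where

  blockEntry : Fin k × Fin m → Fin k × Fin n → A
  blockEntry (j , a) (j′ , b) with j Fin.≟ j′
  ... | yes _ = As j a b
  ... | no  _ = z

  blockDiagonal : Mat A (k ℕ.* m) (k ℕ.* n)
  blockDiagonal p q = blockEntry (remQuot m p) (remQuot n q)

  private
    blockEntry-≡ : ∀ j a b → blockEntry (j , a) (j , b) ≡ As j a b
    blockEntry-≡ j a b with j Fin.≟ j
    ... | yes _   = refl
    ... | no  j≢j = ⊥-elim (j≢j refl)

    blockEntry-≢ : ∀ {j j′} → j ≢ j′ → ∀ a b → blockEntry (j , a) (j′ , b) ≡ z
    blockEntry-≢ {j} {j′} j≢j′ a b with j Fin.≟ j′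
    ... | yes j≡j′ = ⊥-elim (j≢j′ j≡j′)
    ... | no  _    = refl

  blockDiagonal-≡ : ∀ j a b → blockDiagonal (combine j a) (combine j b) ≡ As j a b
  blockDiagonal-≡ j a b = ≡.trans (≡.cong₂ blockEntry (Fin.remQuot-combine j a) (Fin.remQuot-combine j b))
                                  (blockEntry-≡ j a b)

  blockDiagonal-≢ : ∀ {j j′} → j ≢ j′ → ∀ a b → blockDiagonal (combine j a) (combine j′ b) ≡ z
  blockDiagonal-≢ {j} {j′} j≢j′ a b = ≡.trans (≡.cong₂ blockEntry (Fin.remQuot-combine j a) (Fin.remQuot-combine j′ b))
                                              (blockEntry-≢ j≢j′ a b)

-- Column indices of [ Q ⊗ 1ₘ | ⊕ⱼ Sⱼ[1] ]: qCol c is column c of Q ⊗ 1ₘ, sCol j b is column b of Sⱼ[1].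
module Columns (k n : ℕ) where

  private
    e : k ℕ.* suc n ≡ k ℕ.+ k ℕ.* n
    e = ℕ.*-suc k n

  qCol : Fin k → Fin (k ℕ.* suc n)
  qCol c = cast (≡.sym e) (c ↑ˡ k ℕ.* n)

  sCol : Fin k → Fin n → Fin (k ℕ.* suc n)
  sCol j b = cast (≡.sym e) (k ↑ʳ combine j b)

  data Column : Fin (k ℕ.* suc n) → Set where
    qcol : ∀ c → Column (qCol c)
    scol : ∀ j b → Column (sCol j b)

  columnOf : ∀ y → Column y
  columnOf y = ≡.subst Column (Fin.cast-involutive (≡.sym e) e y) (view (cast e y))
    where
    view : ∀ x → Column (cast (≡.sym e) x)
    view x with splitOf k (k ℕ.* n) x
    ... | inl c = qcol c
    ... | inr r with blockOf k n r
    ...   | block j b = scol j b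

  byColumn : ∀ {a} {A : Set a} → (Fin k → A) → (Fin k → Fin n → A) → Fin (k ℕ.* suc n) → A
  byColumn f g y = [ f , uncurry g ∘ remQuot n ]′ (splitAt k (cast e y))

  private
    splitAt-qCol : ∀ c → splitAt k (cast e (qCol c)) ≡ inj₁ c
    splitAt-qCol c = ≡.trans (≡.cong (splitAt k) (Fin.cast-involutive e (≡.sym e) _)) (Fin.splitAt-↑ˡ k c (k ℕ.* n))

    splitAt-sCol : ∀ j b → splitAt k (cast e (sCol j b)) ≡ inj₂ (combine j b)
    splitAt-sCol j b = ≡.trans (≡.cong (splitAt k) (Fin.cast-involutive e (≡.sym e) _)) (Fin.splitAt-↑ʳ k (k ℕ.* n) (combine j b))

  module _ {a} {A : Set a} (f : Fin k → A) (g : Fin k → Fin n → A) where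

    byColumn-qCol : ∀ c → byColumn f g (qCol c) ≡ f c
    byColumn-qCol c = ≡.cong [ f , uncurry g ∘ remQuot n ]′ (splitAt-qCol c)

    byColumn-sCol : ∀ j b → byColumn f g (sCol j b) ≡ g j b
    byColumn-sCol j b = ≡.trans (≡.cong [ f , uncurry g ∘ remQuot n ]′ (splitAt-sCol j b))
                                (≡.cong (uncurry g) (Fin.remQuot-combine j b))

  qCol-injective : ∀ {c d} → qCol c ≡ qCol d → c ≡ d
  qCol-injective {c} {d} eq = inj₁-injective (≡.trans (≡.sym (splitAt-qCol c))
                                (≡.trans (≡.cong (splitAt k ∘ cast e) eq) (splitAt-qCol d)))

  sCol-injective : ∀ {j b j′ b′} → sCol j b ≡ sCol j′ b′ → j ≡ j′ × b ≡ b′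
  sCol-injective {j} {b} {j′} {b′} eq = Fin.combine-injective j b j′ b′ (inj₂-injective
    (≡.trans (≡.sym (splitAt-sCol j b)) (≡.trans (≡.cong (splitAt k ∘ cast e) eq) (splitAt-sCol j′ b′))))

  qCol≢sCol : ∀ {c j b} → qCol c ≢ sCol j b
  qCol≢sCol {c} {j} {b} eq with ≡.trans (≡.sym (splitAt-qCol c)) (≡.trans (≡.cong (splitAt k ∘ cast e) eq) (splitAt-sCol j b))
  ... | ()

module Matrices {c ℓ} (R : CommutativeRing c ℓ) where
  open CommutativeRing R hiding (zero) renaming (refl to ≈-refl)
  open import Algebra.Properties.Semiring.Sum semiring public
    using (sum; sum-cong-≋; ∑-distrib-+; ∑-comm; *-distribˡ-sum; *-distribʳ-sum)
  open import Algebra.Properties.Semiring.Sum semiring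
    using (sum-replicate-zero; sum-remove)
  open import Algebra.Properties.CommutativeSemigroup *-commutativeSemigroup using (x∙yz≈y∙xz)
  open import Relation.Binary.Reasoning.Setoid setoid

  sum-zero : ∀ {n} {f : Vector Carrier n} → (∀ i → f i ≈ 0#) → sum f ≈ 0#
  sum-zero {n} f≈0 = trans (sum-cong-≋ f≈0) (sum-replicate-zero n)

  sum-single : ∀ {n} (i : Fin n) (f : Vector Carrier n) → (∀ j → j ≢ i → f j ≈ 0#) → sum f ≈ f i
  sum-single {suc n} i f off = begin
    sum f                      ≈⟨ sum-remove {i = i} f ⟩
    f i + sum (f ∘ punchIn i)  ≈⟨ +-congˡ (sum-zero (λ j → off (punchIn i j) (Fin.punchInᵢ≢i i j))) ⟩
    f i + 0#                   ≈⟨ +-identityʳ (f i) ⟩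
    f i                        ∎

  sum-split : ∀ m {n} (f : Vector Carrier (m ℕ.+ n)) →
              sum f ≈ sum (f ∘ (_↑ˡ n)) + sum (f ∘ (m ↑ʳ_))
  sum-split zero    f = sym (+-identityˡ _)
  sum-split (suc m) f = trans (+-congˡ (sum-split m (f ∘ suc))) (sym (+-assoc _ _ _))

  sum-combine : ∀ k {m} (f : Vector Carrier (k ℕ.* m)) →
                sum f ≈ sum (λ j → sum (λ a → f (combine {k} j a)))
  sum-combine zero        f = ≈-refl
  sum-combine (suc k) {m} f = trans (sum-split m f) (+-congˡ (sum-combine k (f ∘ (m ↑ʳ_))))

  sum-cast : ∀ {m n} (e : m ≡ n) (f : Vector Carrier n) → sum f ≈ sum (f ∘ cast e)
  sum-cast refl f = sum-cong-≋ (λ i → reflexive (≡.cong f (≡.sym (Fin.cast-is-id refl i))))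

  sum-block : ∀ {k m} (j : Fin k) (f : Vector Carrier (k ℕ.* m)) →
              (∀ j′ a → j′ ≢ j → f (combine j′ a) ≈ 0#) → sum f ≈ sum (λ a → f (combine j a))
  sum-block {k} j f off = trans (sum-combine k f) (sum-single j _ (λ j′ j′≢j → sum-zero (λ a → off j′ a j′≢j)))

  sum-columns : ∀ k n (f : Vector Carrier (k ℕ.* suc n)) → let open Columns k n in
                sum f ≈ sum (f ∘ qCol) + sum (λ j → sum (λ b → f (sCol j b)))
  sum-columns k n f = begin
    sum f                                                  ≈⟨ sum-cast e f ⟩
    sum (f ∘ cast e)                                       ≈⟨ sum-split k (f ∘ cast e) ⟩
    sum (f ∘ qCol) + sum (f ∘ cast e ∘ (k ↑ʳ_))            ≈⟨ +-congˡ (sum-combine k (f ∘ cast e ∘ (k ↑ʳ_))) ⟩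
    sum (f ∘ qCol) + sum (λ j → sum (λ b → f (sCol j b)))  ∎
    where
    open Columns k n
    e : k ℕ.+ k ℕ.* n ≡ k ℕ.* suc n
    e = ≡.sym (ℕ.*-suc k n)

  infix 4 _≈M_
  _≈M_ : ∀ {m n} → Mat Carrier m n → Mat Carrier m n → Set ℓ
  A ≈M B = ∀ i j → A i j ≈ B i j

  -- Defined as OverField._⊛_, so that the two products agree definitionally over a field.
  infixl 7 _⊛_
  _⊛_ : ∀ {m n p} → Mat Carrier m n → Mat Carrier n p → Mat Carrier m p
  (A ⊛ B) i k = sumWith _+_ 0# (λ j → A i j * B j k)

  ⊛-sum : ∀ {m n p} (A : Mat Carrier m n) (B : Mat Carrier n p) i k →
          (A ⊛ B) i k ≡ sum (λ j → A i j * B j k)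
  ⊛-sum A B i k = sumWith≡foldr _+_ 0# (λ j → A i j * B j k)

  1M : ∀ {n} → Mat Carrier n n
  1M i j with i Fin.≟ j
  ... | yes _ = 1#
  ... | no  _ = 0#

  1M-diag : ∀ {n} (i : Fin n) → 1M i i ≈ 1#
  1M-diag i with i Fin.≟ i
  ... | yes _  = ≈-refl
  ... | no i≢i = ⊥-elim (i≢i refl)

  1M-offDiag : ∀ {n} {i j : Fin n} → i ≢ j → 1M i j ≈ 0#
  1M-offDiag {i = i} {j} i≢j with i Fin.≟ j
  ... | yes i≡j = ⊥-elim (i≢j i≡j)
  ... | no  _   = ≈-refl

  1M-reindex : ∀ {m n} (f : Fin m → Fin n) → (∀ {i j} → f i ≡ f j → i ≡ j) →
               ∀ i j → 1M (f i) (f j) ≈ 1M i j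
  1M-reindex f f-inj i j with i Fin.≟ j
  ... | yes refl = 1M-diag (f i)
  ... | no  i≢j  = 1M-offDiag (i≢j ∘ f-inj)

  ⊛-cong : ∀ {m n p} {A A′ : Mat Carrier m n} {B B′ : Mat Carrier n p} →
           A ≈M A′ → B ≈M B′ → A ⊛ B ≈M A′ ⊛ B′
  ⊛-cong {A = A} {A′} {B} {B′} A≈A′ B≈B′ i k = begin
    (A ⊛ B) i k                     ≡⟨ ⊛-sum A B i k ⟩
    sum (λ j → A i j * B j k)       ≈⟨ sum-cong-≋ (λ j → *-cong (A≈A′ i j) (B≈B′ j k)) ⟩
    sum (λ j → A′ i j * B′ j k)     ≡⟨ ⊛-sum A′ B′ i k ⟨
    (A′ ⊛ B′) i k                   ∎

  ⊛-congʳ : ∀ {m n p} (C : Mat Carrier n p) {A B : Mat Carrier m n} → A ≈M B → A ⊛ C ≈M B ⊛ C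
  ⊛-congʳ C A≈B = ⊛-cong A≈B (λ _ _ → ≈-refl)

  ⊛-congˡ : ∀ {m n p} (C : Mat Carrier m n) {A B : Mat Carrier n p} → A ≈M B → C ⊛ A ≈M C ⊛ B
  ⊛-congˡ C A≈B = ⊛-cong (λ _ _ → ≈-refl) A≈B

  ⊛-assoc : ∀ {m n p q} (A : Mat Carrier m n) (B : Mat Carrier n p) (C : Mat Carrier p q) →
            (A ⊛ B) ⊛ C ≈M A ⊛ (B ⊛ C)
  ⊛-assoc A B C i l = begin
    ((A ⊛ B) ⊛ C) i l                                  ≡⟨ ⊛-sum (A ⊛ B) C i l ⟩
    sum (λ k → (A ⊛ B) i k * C k l)                    ≈⟨ sum-cong-≋ (λ k → *-congʳ (reflexive (⊛-sum A B i k))) ⟩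
    sum (λ k → sum (λ j → A i j * B j k) * C k l)      ≈⟨ sum-cong-≋ (λ k → *-distribʳ-sum (C k l) (λ j → A i j * B j k)) ⟩
    sum (λ k → sum (λ j → (A i j * B j k) * C k l))    ≈⟨ ∑-comm (λ k j → (A i j * B j k) * C k l) ⟩
    sum (λ j → sum (λ k → (A i j * B j k) * C k l))    ≈⟨ sum-cong-≋ (λ j → sum-cong-≋ (λ k → *-assoc (A i j) (B j k) (C k l))) ⟩
    sum (λ j → sum (λ k → A i j * (B j k * C k l)))    ≈⟨ sum-cong-≋ (λ j → *-distribˡ-sum (A i j) (λ k → B j k * C k l)) ⟨
    sum (λ j → A i j * sum (λ k → B j k * C k l))      ≈⟨ sum-cong-≋ (λ j → *-congˡ (reflexive (⊛-sum B C j l))) ⟨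
    sum (λ j → A i j * (B ⊛ C) j l)                    ≡⟨ ⊛-sum A (B ⊛ C) i l ⟨
    (A ⊛ (B ⊛ C)) i l                                  ∎

  ⊛-identityˡ : ∀ {m n} (A : Mat Carrier m n) → 1M ⊛ A ≈M A
  ⊛-identityˡ A i k = begin
    (1M ⊛ A) i k               ≡⟨ ⊛-sum 1M A i k ⟩
    sum (λ j → 1M i j * A j k) ≈⟨ sum-single i _ (λ j j≢i → trans (*-congʳ (1M-offDiag (j≢i ∘ ≡.sym))) (zeroˡ _)) ⟩
    1M i i * A i k             ≈⟨ trans (*-congʳ (1M-diag i)) (*-identityˡ _) ⟩
    A i k                      ∎

  _IsInverseOf_ : ∀ {n} → Mat Carrier n n → Mat Carrier n n → Set ℓ
  B IsInverseOf A = B ⊛ A ≈M 1M × A ⊛ B ≈M 1M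

  infixr 8 _·M_
  _·M_ : ∀ {m n} → Carrier → Mat Carrier m n → Mat Carrier m n
  (x ·M A) i j = x * A i j

  ·M-⊛ : ∀ {m n p} x (A : Mat Carrier m n) (B : Mat Carrier n p) → (x ·M A) ⊛ B ≈M x ·M (A ⊛ B)
  ·M-⊛ x A B i k = begin
    ((x ·M A) ⊛ B) i k             ≡⟨ ⊛-sum (x ·M A) B i k ⟩
    sum (λ j → (x * A i j) * B j k) ≈⟨ sum-cong-≋ (λ j → *-assoc x (A i j) (B j k)) ⟩
    sum (λ j → x * (A i j * B j k)) ≈⟨ *-distribˡ-sum x (λ j → A i j * B j k) ⟨
    x * sum (λ j → A i j * B j k)   ≡⟨ ≡.cong (x *_) (⊛-sum A B i k) ⟨
    (x ·M (A ⊛ B)) i k              ∎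

  ⊛-·M : ∀ {m n p} x (A : Mat Carrier m n) (B : Mat Carrier n p) → A ⊛ (x ·M B) ≈M x ·M (A ⊛ B)
  ⊛-·M x A B i k = begin
    (A ⊛ (x ·M B)) i k              ≡⟨ ⊛-sum A (x ·M B) i k ⟩
    sum (λ j → A i j * (x * B j k)) ≈⟨ sum-cong-≋ (λ j → x∙yz≈y∙xz (A i j) x (B j k)) ⟩
    sum (λ j → x * (A i j * B j k)) ≈⟨ *-distribˡ-sum x (λ j → A i j * B j k) ⟨
    x * sum (λ j → A i j * B j k)   ≡⟨ ≡.cong (x *_) (⊛-sum A B i k) ⟨
    (x ·M (A ⊛ B)) i k              ∎

  ⊛-blocks : ∀ {l k m p} (A : Mat Carrier l (k ℕ.* m)) (B : Mat Carrier (k ℕ.* m) p) x y →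
             (A ⊛ B) x y ≈ sum (λ j → sum (λ a → A x (combine {k} j a) * B (combine j a) y))
  ⊛-blocks {k = k} A B x y = trans (reflexive (⊛-sum A B x y)) (sum-combine k (λ q → A x q * B q y))

  ⊛-block : ∀ {l k m p} (A : Mat Carrier l (k ℕ.* m)) (B : Mat Carrier (k ℕ.* m) p) j x y →
            (∀ j′ a → j′ ≢ j → A x (combine j′ a) * B (combine j′ a) y ≈ 0#) →
            (A ⊛ B) x y ≈ sum (λ a → A x (combine {k} j a) * B (combine j a) y)
  ⊛-block A B j x y off = trans (reflexive (⊛-sum A B x y)) (sum-block j (λ q → A x q * B q y) off)

  blockDiagonal-⊛ : ∀ {k m n p} (As : Fin k → Mat Carrier m n) (B : Mat Carrier (k ℕ.* n) p) j a y →
                    (blockDiagonal 0# As ⊛ B) (combine j a) y ≈ sum (λ b → As j a b * B (combine j b) y)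
  blockDiagonal-⊛ As B j a y = begin
    (blockDiagonal 0# As ⊛ B) (combine j a) y                                        ≈⟨ ⊛-block (blockDiagonal 0# As) B j _ y off ⟩
    sum (λ b → blockDiagonal 0# As (combine j a) (combine j b) * B (combine j b) y)  ≈⟨ sum-cong-≋ same ⟩
    sum (λ b → As j a b * B (combine j b) y)                                         ∎
    where
    off : ∀ j′ b → j′ ≢ j → blockDiagonal 0# As (combine j a) (combine j′ b) * B (combine j′ b) y ≈ 0#
    off j′ b j′≢j = trans (*-congʳ (reflexive (blockDiagonal-≢ 0# As (j′≢j ∘ ≡.sym) a b))) (zeroˡ _)
    same : ∀ b → blockDiagonal 0# As (combine j a) (combine j b) * B (combine j b) y ≈ As j a b * B (combine j b) y
    same b = *-congʳ (reflexive (blockDiagonal-≡ 0# As j a b))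

-- Integer matrices: doubling and the matrices Qbase

module ℤMatrices = Matrices ℤ.+-*-commutativeRing

module IntegerMatrices where
  open ℤMatrices
  open ≡.≡-Reasoning

  decide : ∀ {m n} {P : Fin m → Fin n → Set} (P? : ∀ i j → Dec (P i j)) →
           {True (Fin.all? λ i → Fin.all? λ j → P? i j)} → ∀ i j → P i j
  decide P? {holds} = toWitness holds

  trit? : ∀ x → Dec (Trit x)
  trit? (+ 0)               = yes t0
  trit? (+ 1)               = yes t1
  trit? (+ suc (suc _))     = no λ ()
  trit? -[1+ 0 ]            = yes t-1
  trit? -[1+ suc _ ]        = no λ ()

  trit-neg : ∀ {x} → Trit x → Trit (ℤ.- x)
  trit-neg t-1 = t1
  trit-neg t0  = t0
  trit-neg t1  = t-1

  gram-comm : ∀ {m n} (M : Mat ℤ m n) i j → gramℤ M i j ≡ gramℤ M j i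
  gram-comm M i j = begin
    gramℤ M i j                 ≡⟨ ⊛-sum (M ᵀ) M i j ⟩
    sum (λ r → M r i ℤ.* M r j) ≡⟨ sum-cong-≋ (λ r → ℤ.*-comm (M r i) (M r j)) ⟩
    sum (λ r → M r j ℤ.* M r i) ≡⟨ ⊛-sum (M ᵀ) M j i ⟨
    gramℤ M j i                 ∎

  orthogonal⇒weakHadamard : ∀ {n} {M : Mat ℤ n n} → (∀ i j → Trit (M i j)) → OrthogonalColumns M → WeakHadamard M
  orthogonal⇒weakHadamard trits orth = trits , λ i j far → orth i j (λ { refl → apart-irrefl far })
    where
    apart-irrefl : ∀ {t} → suc t ℕ.< t ⊎ suc t ℕ.< t → ⊥
    apart-irrefl (inj₁ t+1<t) = ℕ.1+n≰n (ℕ.<⇒≤ t+1<t)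
    apart-irrefl (inj₂ t+1<t) = ℕ.1+n≰n (ℕ.<⇒≤ t+1<t)

  ScaledInverse : ∀ {d} → ℤ → Mat ℤ d d → Mat ℤ d d → Set
  ScaledInverse s B M = B ⊛ M ≈M s ·M 1M × M ⊛ B ≈M s ·M 1M

  HasScaledInverse : ∀ {d} → Mat ℤ d d → Set
  HasScaledInverse {d} M = Σ ℕ λ s → Σ (Mat ℤ d d) λ B → ScaledInverse (+ suc s) B M

  module _ {d} (A : Mat ℤ d d) where

    doubleM-ll : ∀ i j → doubleM A (i ↑ˡ d) (j ↑ˡ d) ≡ A i j
    doubleM-ll i j rewrite Fin.splitAt-↑ˡ d i d | Fin.splitAt-↑ˡ d j d = refl

    doubleM-lr : ∀ i j → doubleM A (i ↑ˡ d) (d ↑ʳ j) ≡ A i j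
    doubleM-lr i j rewrite Fin.splitAt-↑ˡ d i d | Fin.splitAt-↑ʳ d d j = refl

    doubleM-rl : ∀ i j → doubleM A (d ↑ʳ i) (j ↑ˡ d) ≡ A i j
    doubleM-rl i j rewrite Fin.splitAt-↑ʳ d d i | Fin.splitAt-↑ˡ d j d = refl

    doubleM-rr : ∀ i j → doubleM A (d ↑ʳ i) (d ↑ʳ j) ≡ ℤ.- A i j
    doubleM-rr i j rewrite Fin.splitAt-↑ʳ d d i | Fin.splitAt-↑ʳ d d j = refl

    doubleM-ᵀ : ∀ x y → (doubleM A ᵀ) x y ≡ doubleM (A ᵀ) x y
    doubleM-ᵀ x y with splitAt d x | splitAt d y
    ... | inj₁ _ | inj₁ _ = refl
    ... | inj₁ _ | inj₂ _ = refl
    ... | inj₂ _ | inj₁ _ = refl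
    ... | inj₂ _ | inj₂ _ = refl

    trits-doubleM : (∀ i j → Trit (A i j)) → ∀ x y → Trit (doubleM A x y)
    trits-doubleM trits x y with splitAt d x | splitAt d y
    ... | inj₁ i | inj₁ j = trits i j
    ... | inj₁ i | inj₂ j = trits i j
    ... | inj₂ i | inj₁ j = trits i j
    ... | inj₂ i | inj₂ j = trit-neg (trits i j)

  module _ {d} (A B : Mat ℤ d d) where

    private
      halves : ∀ x y → (doubleM A ⊛ doubleM B) x y ≡
               sum (λ z → doubleM A x (z ↑ˡ d) ℤ.* doubleM B (z ↑ˡ d) y) ℤ.+
               sum (λ z → doubleM A x (d ↑ʳ z) ℤ.* doubleM B (d ↑ʳ z) y)
      halves x y = ≡.trans (⊛-sum (doubleM A) (doubleM B) x y) (sum-split d _)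

      cancel : ∀ {f g : Fin d → ℤ} → (∀ z → f z ℤ.+ g z ≡ 0ℤ) → sum f ℤ.+ sum g ≡ 0ℤ
      cancel {f} {g} f+g≡0 = ≡.trans (≡.sym (∑-distrib-+ f g)) (sum-zero f+g≡0)

    doubleM-⊛-ll : ∀ i j → (doubleM A ⊛ doubleM B) (i ↑ˡ d) (j ↑ˡ d) ≡ (A ⊛ B) i j ℤ.+ (A ⊛ B) i j
    doubleM-⊛-ll i j = begin
      _                                                         ≡⟨ halves _ _ ⟩
      _                                                         ≡⟨ ≡.cong₂ ℤ._+_ (sum-cong-≋ λ z → ≡.cong₂ ℤ._*_ (doubleM-ll A i z) (doubleM-ll B z j))
                                                                                 (sum-cong-≋ λ z → ≡.cong₂ ℤ._*_ (doubleM-lr A i z) (doubleM-rl B z j)) ⟩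
      sum (λ z → A i z ℤ.* B z j) ℤ.+ sum (λ z → A i z ℤ.* B z j) ≡⟨ ≡.cong₂ ℤ._+_ (⊛-sum A B i j) (⊛-sum A B i j) ⟨
      (A ⊛ B) i j ℤ.+ (A ⊛ B) i j                               ∎

    doubleM-⊛-lr : ∀ i j → (doubleM A ⊛ doubleM B) (i ↑ˡ d) (d ↑ʳ j) ≡ 0ℤ
    doubleM-⊛-lr i j = ≡.trans (halves _ _) (cancel λ z → begin
      doubleM A (i ↑ˡ d) (z ↑ˡ d) ℤ.* doubleM B (z ↑ˡ d) (d ↑ʳ j) ℤ.+ doubleM A (i ↑ˡ d) (d ↑ʳ z) ℤ.* doubleM B (d ↑ʳ z) (d ↑ʳ j)
        ≡⟨ ≡.cong₂ ℤ._+_ (≡.cong₂ ℤ._*_ (doubleM-ll A i z) (doubleM-lr B z j)) (≡.cong₂ ℤ._*_ (doubleM-lr A i z) (doubleM-rr B z j)) ⟩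
      A i z ℤ.* B z j ℤ.+ A i z ℤ.* ℤ.- B z j          ≡⟨ ℤ.*-distribˡ-+ (A i z) (B z j) (ℤ.- B z j) ⟨
      A i z ℤ.* (B z j ℤ.+ ℤ.- B z j)                 ≡⟨ ≡.cong (A i z ℤ.*_) (ℤ.+-inverseʳ (B z j)) ⟩
      A i z ℤ.* 0ℤ                                    ≡⟨ ℤ.*-zeroʳ (A i z) ⟩
      0ℤ                                              ∎)

    doubleM-⊛-rl : ∀ i j → (doubleM A ⊛ doubleM B) (d ↑ʳ i) (j ↑ˡ d) ≡ 0ℤ
    doubleM-⊛-rl i j = ≡.trans (halves _ _) (cancel λ z → begin
      doubleM A (d ↑ʳ i) (z ↑ˡ d) ℤ.* doubleM B (z ↑ˡ d) (j ↑ˡ d) ℤ.+ doubleM A (d ↑ʳ i) (d ↑ʳ z) ℤ.* doubleM B (d ↑ʳ z) (j ↑ˡ d)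
        ≡⟨ ≡.cong₂ ℤ._+_ (≡.cong₂ ℤ._*_ (doubleM-rl A i z) (doubleM-ll B z j)) (≡.cong₂ ℤ._*_ (doubleM-rr A i z) (doubleM-rl B z j)) ⟩
      A i z ℤ.* B z j ℤ.+ ℤ.- A i z ℤ.* B z j         ≡⟨ ℤ.*-distribʳ-+ (B z j) (A i z) (ℤ.- A i z) ⟨
      (A i z ℤ.+ ℤ.- A i z) ℤ.* B z j                 ≡⟨ ≡.cong (ℤ._* B z j) (ℤ.+-inverseʳ (A i z)) ⟩
      0ℤ ℤ.* B z j                                    ≡⟨ ℤ.*-zeroˡ (B z j) ⟩
      0ℤ                                              ∎)

    doubleM-⊛-rr : ∀ i j → (doubleM A ⊛ doubleM B) (d ↑ʳ i) (d ↑ʳ j) ≡ (A ⊛ B) i j ℤ.+ (A ⊛ B) i j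
    doubleM-⊛-rr i j = begin
      _                                                         ≡⟨ halves _ _ ⟩
      _                                                         ≡⟨ ≡.cong₂ ℤ._+_ (sum-cong-≋ λ z → ≡.cong₂ ℤ._*_ (doubleM-rl A i z) (doubleM-lr B z j))
                                                                                 (sum-cong-≋ λ z → negated-product z) ⟩
      sum (λ z → A i z ℤ.* B z j) ℤ.+ sum (λ z → A i z ℤ.* B z j) ≡⟨ ≡.cong₂ ℤ._+_ (⊛-sum A B i j) (⊛-sum A B i j) ⟨
      (A ⊛ B) i j ℤ.+ (A ⊛ B) i j                               ∎
      where
      negated-product : ∀ z → doubleM A (d ↑ʳ i) (d ↑ʳ z) ℤ.* doubleM B (d ↑ʳ z) (d ↑ʳ j) ≡ A i z ℤ.* B z j
      negated-product z = begin
        doubleM A (d ↑ʳ i) (d ↑ʳ z) ℤ.* doubleM B (d ↑ʳ z) (d ↑ʳ j) ≡⟨ ≡.cong₂ ℤ._*_ (doubleM-rr A i z) (doubleM-rr B z j) ⟩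
        ℤ.- A i z ℤ.* ℤ.- B z j                                     ≡⟨ ℤ.neg-distribˡ-* (A i z) (ℤ.- B z j) ⟨
        ℤ.- (A i z ℤ.* ℤ.- B z j)                                   ≡⟨ ≡.cong ℤ.-_ (ℤ.neg-distribʳ-* (A i z) (B z j)) ⟨
        ℤ.- ℤ.- (A i z ℤ.* B z j)                                   ≡⟨ ℤ.neg-involutive _ ⟩
        A i z ℤ.* B z j                                             ∎

  orthogonal-doubleM : ∀ {d} (A : Mat ℤ d d) → OrthogonalColumns A → OrthogonalColumns (doubleM A)
  orthogonal-doubleM {d} A orth x y x≢y = begin
    gramℤ (doubleM A) x y                  ≡⟨⟩
    (doubleM A ᵀ ⊛ doubleM A) x y          ≡⟨ ⊛-congʳ (doubleM A) (doubleM-ᵀ A) x y ⟩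
    (doubleM (A ᵀ) ⊛ doubleM A) x y        ≡⟨ blocks (splitOf d d x) (splitOf d d y) x≢y ⟩
    0ℤ                                     ∎
    where
    blocks : ∀ {x y} → Split d d x → Split d d y → x ≢ y → (doubleM (A ᵀ) ⊛ doubleM A) x y ≡ 0ℤ
    blocks (inl i) (inl j) x≢y = ≡.trans (doubleM-⊛-ll (A ᵀ) A i j)
      (≡.cong₂ ℤ._+_ (orth i j (x≢y ∘ ≡.cong (_↑ˡ d))) (orth i j (x≢y ∘ ≡.cong (_↑ˡ d))))
    blocks (inl i) (inr j) _   = doubleM-⊛-lr (A ᵀ) A i j
    blocks (inr i) (inl j) _   = doubleM-⊛-rl (A ᵀ) A i j
    blocks (inr i) (inr j) x≢y = ≡.trans (doubleM-⊛-rr (A ᵀ) A i j)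
      (≡.cong₂ ℤ._+_ (orth i j (x≢y ∘ ≡.cong (d ↑ʳ_))) (orth i j (x≢y ∘ ≡.cong (d ↑ʳ_))))

  scaledIdentity-doubleM : ∀ {d} s (A B : Mat ℤ d d) → A ⊛ B ≈M s ·M 1M → doubleM A ⊛ doubleM B ≈M (s ℤ.+ s) ·M 1M
  scaledIdentity-doubleM {d} s A B AB≈sI x y = blocks (splitOf d d x) (splitOf d d y)
    where
    diagonalBlock : ∀ {i j} x y → 1M x y ≡ 1M i j → (A ⊛ B) i j ℤ.+ (A ⊛ B) i j ≡ (s ℤ.+ s) ℤ.* 1M x y
    diagonalBlock {i} {j} x y 1M≡ = begin
      (A ⊛ B) i j ℤ.+ (A ⊛ B) i j         ≡⟨ ≡.cong₂ ℤ._+_ (AB≈sI i j) (AB≈sI i j) ⟩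
      s ℤ.* 1M i j ℤ.+ s ℤ.* 1M i j       ≡⟨ ℤ.*-distribʳ-+ (1M i j) s s ⟨
      (s ℤ.+ s) ℤ.* 1M i j                ≡⟨ ≡.cong ((s ℤ.+ s) ℤ.*_) 1M≡ ⟨
      (s ℤ.+ s) ℤ.* 1M x y                ∎
    offDiagonalBlock : ∀ {x y : Fin (d ℕ.+ d)} → x ≢ y → 0ℤ ≡ (s ℤ.+ s) ℤ.* 1M x y
    offDiagonalBlock x≢y = ≡.sym (≡.trans (≡.cong ((s ℤ.+ s) ℤ.*_) (1M-offDiag x≢y)) (ℤ.*-zeroʳ (s ℤ.+ s)))
    blocks : ∀ {x y} → Split d d x → Split d d y → (doubleM A ⊛ doubleM B) x y ≡ (s ℤ.+ s) ℤ.* 1M x y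
    blocks (inl i) (inl j) = ≡.trans (doubleM-⊛-ll A B i j) (diagonalBlock (i ↑ˡ d) (j ↑ˡ d) (1M-reindex (_↑ˡ d) (Fin.↑ˡ-injective d _ _) i j))
    blocks (inl i) (inr j) = ≡.trans (doubleM-⊛-lr A B i j) (offDiagonalBlock (↑ˡ≢↑ʳ i j))
    blocks (inr i) (inl j) = ≡.trans (doubleM-⊛-rl A B i j) (offDiagonalBlock (↑ˡ≢↑ʳ j i ∘ ≡.sym))
    blocks (inr i) (inr j) = ≡.trans (doubleM-⊛-rr A B i j) (diagonalBlock (d ↑ʳ i) (d ↑ʳ j) (1M-reindex (d ↑ʳ_) (Fin.↑ʳ-injective d _ _) i j))

  scaledInverse-doubleM : ∀ {d} {A : Mat ℤ d d} → HasScaledInverse A → HasScaledInverse (doubleM A)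
  scaledInverse-doubleM (s , B , BA≈sI , AB≈sI) =
    s ℕ.+ suc s , doubleM B , scaledIdentity-doubleM (+ suc s) B _ BA≈sI , scaledIdentity-doubleM (+ suc s) _ B AB≈sI

  H2-trits : ∀ i j → Trit (H2 i j)
  H2-trits = decide (λ i j → trit? (H2 i j))

  H2-orthogonal : OrthogonalColumns H2
  H2-orthogonal = decide (λ i j → ¬? (i Fin.≟ j) →-dec gramℤ H2 i j ℤ.≟ 0ℤ)

  H2-scaledInverse : HasScaledInverse H2
  H2-scaledInverse = 1 , H2 , decide (λ i j → (H2 ⊛ H2) i j ℤ.≟ ((+ 2) ·M 1M) i j)
                            , decide (λ i j → (H2 ⊛ H2) i j ℤ.≟ ((+ 2) ·M 1M) i j)

  P1-trits : ∀ i j → Trit (P1 i j)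
  P1-trits = decide (λ i j → trit? (P1 i j))

  P1-orthogonal : OrthogonalColumns P1
  P1-orthogonal = decide (λ i j → ¬? (i Fin.≟ j) →-dec gramℤ P1 i j ℤ.≟ 0ℤ)

  P1-scaledInverse : HasScaledInverse P1
  P1-scaledInverse = 3 , B , decide (λ i j → (B ⊛ P1) i j ℤ.≟ ((+ 4) ·M 1M) i j)
                           , decide (λ i j → (P1 ⊛ B) i j ℤ.≟ ((+ 4) ·M 1M) i j)
    where
    -- 4 P1⁻¹ = diag(1, 2, 1, 2) P1ᵀ, as the columns of P1 have squared norms 4, 2, 4, 2
    B : Mat ℤ 4 4
    B c r = weight c ℤ.* P1 r c
      where
      weight : Fin 4 → ℤ
      weight zero                   = + 1
      weight (suc zero)             = + 2
      weight (suc (suc zero))       = + 1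
      weight (suc (suc (suc zero))) = + 2

  Qbase-induction : (P : ∀ {d} → Mat ℤ d d → Set) →
                    (∀ {d} {A A′ : Mat ℤ d d} → (∀ i j → A i j ≡ A′ i j) → P A → P A′) →
                    P H2 → P P1 → (∀ {d} {A : Mat ℤ d d} → P A → P (doubleM A)) →
                    ∀ ℓ → 1 ≤ ℓ → P (Qbase ℓ)
  Qbase-induction P P-resp P-H2 P-P1 P-doubleM (suc zero)    _ = P-H2
  Qbase-induction P P-resp P-H2 P-P1 P-doubleM (suc (suc i)) _ = P-castM (dimP≡ i) (P-Pmat i)
    where
    P-Pmat : ∀ i → P (Pmat i)
    P-Pmat zero    = P-P1
    P-Pmat (suc i) = P-doubleM (P-Pmat i)
    P-castM : ∀ {d d′} (e : d ≡ d′) {A : Mat ℤ d d} → P A → P (castM e e A)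
    P-castM refl {A} = P-resp (λ i j → ≡.sym (≡.cong₂ A (Fin.cast-is-id refl i) (Fin.cast-is-id refl j)))

  Qbase-trits : ∀ ℓ → 1 ≤ ℓ → ∀ i j → Trit (Qbase ℓ i j)
  Qbase-trits = Qbase-induction (λ A → ∀ i j → Trit (A i j))
    (λ A≡A′ trits i j → ≡.subst Trit (A≡A′ i j) (trits i j)) H2-trits P1-trits (trits-doubleM _)

  Qbase-orthogonal : ∀ ℓ → 1 ≤ ℓ → OrthogonalColumns (Qbase ℓ)
  Qbase-orthogonal = Qbase-induction OrthogonalColumns orthogonal-resp H2-orthogonal P1-orthogonal (orthogonal-doubleM _)
    where
    orthogonal-resp : ∀ {d} {A A′ : Mat ℤ d d} → (∀ i j → A i j ≡ A′ i j) → OrthogonalColumns A → OrthogonalColumns A′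
    orthogonal-resp A≡A′ orth i j i≢j =
      ≡.trans (⊛-cong (λ r c → ≡.sym (A≡A′ c r)) (λ r c → ≡.sym (A≡A′ r c)) i j) (orth i j i≢j)

  Qbase-scaledInverse : ∀ ℓ → 1 ≤ ℓ → HasScaledInverse (Qbase ℓ)
  Qbase-scaledInverse = Qbase-induction HasScaledInverse scaledInverse-resp H2-scaledInverse P1-scaledInverse scaledInverse-doubleM
    where
    scaledInverse-resp : ∀ {d} {A A′ : Mat ℤ d d} → (∀ i j → A i j ≡ A′ i j) → HasScaledInverse A → HasScaledInverse A′
    scaledInverse-resp {A = A} {A′} A≡A′ (s , B , BA≈sI , AB≈sI) = s , B ,
      (λ i j → ≡.trans (⊛-congˡ B (λ r c → ≡.sym (A≡A′ r c)) i j) (BA≈sI i j)) ,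
      (λ i j → ≡.trans (⊛-congʳ B (λ r c → ≡.sym (A≡A′ r c)) i j) (AB≈sI i j))

hcat-↑ˡ : ∀ {m n n′} (A : Mat ℤ m n) (B : Mat ℤ m n′) i c → hcat A B i (c ↑ˡ n′) ≡ A i c
hcat-↑ˡ {n = n} {n′} A B i c rewrite Fin.splitAt-↑ˡ n c n′ = refl

hcat-↑ʳ : ∀ {m n n′} (A : Mat ℤ m n) (B : Mat ℤ m n′) i c → hcat A B i (n ↑ʳ c) ≡ B i c
hcat-↑ʳ {n = n} {n′} A B i c rewrite Fin.splitAt-↑ʳ n n′ c = refl

directSum≡blockDiagonal : ∀ {k m n} (As : Fin k → Mat ℤ m n) p q → directSum As p q ≡ blockDiagonal 0ℤ As p q
directSum≡blockDiagonal {k} {m} {n} As p q with Fin.quotRem {k} m p | Fin.quotRem {k} n q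
... | _ , j | _ , j′ with j Fin.≟ j′
...   | yes _ = refl
...   | no  _ = refl

module BigT (ℓ n : ℕ) (S : Fin (2 ^ ℓ) → Mat ℤ (suc n) (suc n)) where
  open ℤMatrices
  open IntegerMatrices
  open ≡.≡-Reasoning

  k m : ℕ
  k = 2 ^ ℓ
  m = suc n

  open Columns k n public

  T : Mat ℤ (k ℕ.* m) (k ℕ.* m)
  T = bigT ℓ n S

  private
    S′ : Fin k → Mat ℤ m n
    S′ j = dropFirstCol (S j)

    e : k ℕ.* m ≡ k ℕ.+ k ℕ.* n
    e = ℕ.*-suc k n

    T≡hcat : ∀ p y → T p y ≡ hcat (Qmat ℓ m) (directSum S′) p (cast e y)
    T≡hcat p y = ≡.cong (λ p → hcat (Qmat ℓ m) (directSum S′) p _) (Fin.cast-is-id refl p)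

    T-sCol : ∀ p j b → T p (sCol j b) ≡ blockDiagonal 0ℤ S′ p (combine j b)
    T-sCol p j b = begin
      T p (sCol j b)                                        ≡⟨ T≡hcat p (sCol j b) ⟩
      hcat (Qmat ℓ m) (directSum S′) p (cast e (sCol j b))  ≡⟨ ≡.cong (hcat (Qmat ℓ m) (directSum S′) p) (Fin.cast-involutive e (≡.sym e) _) ⟩
      hcat (Qmat ℓ m) (directSum S′) p (k ↑ʳ combine j b)   ≡⟨ hcat-↑ʳ (Qmat ℓ m) (directSum S′) p (combine j b) ⟩
      directSum S′ p (combine j b)                          ≡⟨ directSum≡blockDiagonal S′ p (combine j b) ⟩
      blockDiagonal 0ℤ S′ p (combine j b)                   ∎

  T-qCol : ∀ j a c → T (combine j a) (qCol c) ≡ Qbase ℓ j c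
  T-qCol j a c = begin
    T (combine j a) (qCol c)                                        ≡⟨ T≡hcat (combine j a) (qCol c) ⟩
    hcat (Qmat ℓ m) (directSum S′) (combine j a) (cast e (qCol c))  ≡⟨ ≡.cong (hcat (Qmat ℓ m) (directSum S′) (combine j a)) (Fin.cast-involutive e (≡.sym e) _) ⟩
    hcat (Qmat ℓ m) (directSum S′) (combine j a) (c ↑ˡ k ℕ.* n)     ≡⟨ hcat-↑ˡ (Qmat ℓ m) (directSum S′) (combine j a) c ⟩
    Qbase ℓ (proj₁ (remQuot {k} m (combine j a))) c                 ≡⟨ ≡.cong (λ x → Qbase ℓ (proj₁ x) c) (Fin.remQuot-combine j a) ⟩
    Qbase ℓ j c                                                     ∎

  T-sCol-≡ : ∀ j a b → T (combine j a) (sCol j b) ≡ S j a (suc b)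
  T-sCol-≡ j a b = ≡.trans (T-sCol _ j b) (blockDiagonal-≡ 0ℤ S′ j a b)

  T-sCol-≢ : ∀ {j j′} → j ≢ j′ → ∀ a b → T (combine j a) (sCol j′ b) ≡ 0ℤ
  T-sCol-≢ j≢j′ a b = ≡.trans (T-sCol _ _ b) (blockDiagonal-≢ 0ℤ S′ j≢j′ a b)

  T-trits : (∀ i j → Trit (Qbase ℓ i j)) → (∀ j a b → Trit (S j a b)) → ∀ p y → Trit (T p y)
  T-trits Q-trits S-trits p y with blockOf k m p | columnOf y
  ... | block j a | qcol c    = ≡.subst Trit (≡.sym (T-qCol j a c)) (Q-trits j c)
  ... | block j a | scol j′ b with j Fin.≟ j′
  ...   | yes refl = ≡.subst Trit (≡.sym (T-sCol-≡ j a b)) (S-trits j a (suc b))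
  ...   | no  j≢j′ = ≡.subst Trit (≡.sym (T-sCol-≢ j≢j′ a b)) t0

  module _ (Q-orthogonal : OrthogonalColumns (Qbase ℓ)) (S-orthogonal : ∀ j → OrthogonalColumns (S j))
           (S-columnSums : ∀ j b → sum (λ a → S j a (suc b)) ≡ 0ℤ) where

    private
      vanishʳ : ∀ x {y} → y ≡ 0ℤ → x ℤ.* y ≡ 0ℤ
      vanishʳ x refl = ℤ.*-zeroʳ x

      vanishˡ : ∀ {x} y → x ≡ 0ℤ → x ℤ.* y ≡ 0ℤ
      vanishˡ y refl = ℤ.*-zeroˡ y

      gram-qq : ∀ {c d} → c ≢ d → gramℤ T (qCol c) (qCol d) ≡ 0ℤ
      gram-qq {c} {d} c≢d = begin
        gramℤ T (qCol c) (qCol d)                                   ≡⟨ ⊛-blocks {k = k} {m = m} (T ᵀ) T (qCol c) (qCol d) ⟩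
        sum (λ (j : Fin k) → sum (λ (a : Fin m) → T (combine j a) (qCol c) ℤ.* T (combine j a) (qCol d)))
                                                                    ≡⟨ sum-cong-≋ (λ j → sum-cong-≋ λ a → ≡.cong₂ ℤ._*_ (T-qCol j a c) (T-qCol j a d)) ⟩
        sum (λ j → sum (λ (a : Fin m) → Qbase ℓ j c ℤ.* Qbase ℓ j d)) ≡⟨ ∑-comm (λ j (a : Fin m) → Qbase ℓ j c ℤ.* Qbase ℓ j d) ⟩
        sum (λ (a : Fin m) → sum (λ j → Qbase ℓ j c ℤ.* Qbase ℓ j d)) ≡⟨ sum-zero {m} (λ _ → Q-cd) ⟩
        0ℤ                                                          ∎
        where
        Q-cd : sum (λ j → Qbase ℓ j c ℤ.* Qbase ℓ j d) ≡ 0ℤ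
        Q-cd = ≡.trans (≡.sym (⊛-sum (Qbase ℓ ᵀ) (Qbase ℓ) c d)) (Q-orthogonal c d c≢d)

      gram-qs : ∀ c j b → gramℤ T (qCol c) (sCol j b) ≡ 0ℤ
      gram-qs c j b = begin
        gramℤ T (qCol c) (sCol j b)                       ≡⟨ ⊛-block {k = k} {m = m} (T ᵀ) T j _ _ (λ j′ a j′≢j → vanishʳ (T (combine j′ a) (qCol c)) (T-sCol-≢ j′≢j a b)) ⟩
        _                                                 ≡⟨ sum-cong-≋ (λ a → ≡.cong₂ ℤ._*_ (T-qCol j a c) (T-sCol-≡ j a b)) ⟩
        sum (λ a → Qbase ℓ j c ℤ.* S j a (suc b))         ≡⟨ *-distribˡ-sum (Qbase ℓ j c) (λ a → S j a (suc b)) ⟨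
        Qbase ℓ j c ℤ.* sum (λ a → S j a (suc b))         ≡⟨ ≡.cong (Qbase ℓ j c ℤ.*_) (S-columnSums j b) ⟩
        Qbase ℓ j c ℤ.* 0ℤ                                ≡⟨ ℤ.*-zeroʳ (Qbase ℓ j c) ⟩
        0ℤ                                                ∎

      gram-ss : ∀ {j b j′ b′} → sCol j b ≢ sCol j′ b′ → gramℤ T (sCol j b) (sCol j′ b′) ≡ 0ℤ
      gram-ss {j} {b} {j′} {b′} ≢ with j Fin.≟ j′
      ... | yes refl = begin
        gramℤ T (sCol j b) (sCol j b′)                    ≡⟨ ⊛-block {k = k} {m = m} (T ᵀ) T j _ _ (λ j″ a j″≢j → vanishʳ (T (combine j″ a) (sCol j b)) (T-sCol-≢ j″≢j a b′)) ⟩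
        _                                                 ≡⟨ sum-cong-≋ (λ a → ≡.cong₂ ℤ._*_ (T-sCol-≡ j a b) (T-sCol-≡ j a b′)) ⟩
        sum (λ a → S j a (suc b) ℤ.* S j a (suc b′))      ≡⟨ ⊛-sum (S j ᵀ) (S j) (suc b) (suc b′) ⟨
        gramℤ (S j) (suc b) (suc b′)                      ≡⟨ S-orthogonal j (suc b) (suc b′) (≢ ∘ ≡.cong (sCol j) ∘ Fin.suc-injective) ⟩
        0ℤ                                                ∎
      ... | no j≢j′ = begin
        gramℤ T (sCol j b) (sCol j′ b′)                   ≡⟨ ⊛-block {k = k} {m = m} (T ᵀ) T j′ _ _ (λ j″ a j″≢j′ → vanishʳ (T (combine j″ a) (sCol j b)) (T-sCol-≢ j″≢j′ a b′)) ⟩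
        sum (λ a → T (combine j′ a) (sCol j b) ℤ.* T (combine j′ a) (sCol j′ b′))
                                                          ≡⟨ sum-zero (λ a → vanishˡ (T (combine j′ a) (sCol j′ b′)) (T-sCol-≢ (j≢j′ ∘ ≡.sym) a b)) ⟩
        0ℤ                                                ∎

    T-orthogonal : OrthogonalColumns T
    T-orthogonal x y x≢y with columnOf x | columnOf y
    ... | qcol c    | qcol d    = gram-qq (x≢y ∘ ≡.cong qCol)
    ... | qcol c    | scol j b  = gram-qs c j b
    ... | scol j b  | qcol c    = ≡.trans (gram-comm T _ _) (gram-qs c j b)
    ... | scol j b  | scol j′ b′ = gram-ss x≢y

module IntegerEmbedding {c ℓ} (R : CommutativeRing c ℓ) where
  open CommutativeRing R hiding (zero) renaming (refl to ≈-refl)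
  open RingStuff R
  open Matrices R
  private module ℤM = ℤMatrices
  open import Algebra.Properties.Ring ring using (-0#≈0#; -‿involutive; -‿+-comm; -‿distribˡ-*; -‿distribʳ-*)
  open import Algebra.Properties.CommutativeSemigroup +-commutativeSemigroup using (interchange)
  open import Algebra.Properties.Semiring.Mult semiring using (×-homo-+; ×1-homo-*) renaming (_×_ to _×ₙ_)
  open import Relation.Binary.Reasoning.Setoid setoid

  ιℕ≈×1 : ∀ n → ιℕ n ≈ n ×ₙ 1#
  ιℕ≈×1 zero    = ≈-refl
  ιℕ≈×1 (suc n) = +-congˡ (ιℕ≈×1 n)

  ιℕ-+ : ∀ a b → ιℕ (a ℕ.+ b) ≈ ιℕ a + ιℕ b
  ιℕ-+ a b = begin
    ιℕ (a ℕ.+ b)          ≈⟨ ιℕ≈×1 (a ℕ.+ b) ⟩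
    (a ℕ.+ b) ×ₙ 1#       ≈⟨ ×-homo-+ 1# a b ⟩
    a ×ₙ 1# + b ×ₙ 1#     ≈⟨ +-cong (ιℕ≈×1 a) (ιℕ≈×1 b) ⟨
    ιℕ a + ιℕ b           ∎

  ιℕ-* : ∀ a b → ιℕ (a ℕ.* b) ≈ ιℕ a * ιℕ b
  ιℕ-* a b = begin
    ιℕ (a ℕ.* b)          ≈⟨ ιℕ≈×1 (a ℕ.* b) ⟩
    (a ℕ.* b) ×ₙ 1#       ≈⟨ ×1-homo-* a b ⟩
    (a ×ₙ 1#) * (b ×ₙ 1#) ≈⟨ *-cong (ιℕ≈×1 a) (ιℕ≈×1 b) ⟨
    ιℕ a * ιℕ b           ∎

  ι-cong : ∀ {x y} → x ≡ y → ι x ≈ ι y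
  ι-cong refl = ≈-refl

  ι-1 : ι 1ℤ ≈ 1#
  ι-1 = +-identityʳ 1#

  ι-neg : ∀ x → ι (ℤ.- x) ≈ - ι x
  ι-neg (+ zero)  = sym -0#≈0#
  ι-neg (+ suc n) = ≈-refl
  ι-neg -[1+ n ]  = sym (-‿involutive _)

  ι-⊖ : ∀ a b → ι (a ⊖ b) ≈ ιℕ a + - ιℕ b
  ι-⊖ a       zero    = sym (trans (+-congˡ -0#≈0#) (+-identityʳ _))
  ι-⊖ zero    (suc b) = sym (+-identityˡ _)
  ι-⊖ (suc a) (suc b) = begin
    ι (suc a ⊖ suc b)                    ≈⟨ ι-cong (ℤ.[1+m]⊖[1+n]≡m⊖n a b) ⟩
    ι (a ⊖ b)                            ≈⟨ ι-⊖ a b ⟩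
    ιℕ a + - ιℕ b                        ≈⟨ +-identityˡ _ ⟨
    0# + (ιℕ a + - ιℕ b)                 ≈⟨ +-congʳ (-‿inverseʳ 1#) ⟨
    (1# + - 1#) + (ιℕ a + - ιℕ b)        ≈⟨ interchange 1# (- 1#) (ιℕ a) (- ιℕ b) ⟩
    (1# + ιℕ a) + (- 1# + - ιℕ b)        ≈⟨ +-congˡ (-‿+-comm 1# (ιℕ b)) ⟩
    (1# + ιℕ a) + - (1# + ιℕ b)          ∎

  ι-+ : ∀ x y → ι (x ℤ.+ y) ≈ ι x + ι y
  ι-+ (+ a)    (+ b)    = ιℕ-+ a b
  ι-+ (+ a)    -[1+ b ] = ι-⊖ a (suc b)
  ι-+ -[1+ a ] (+ b)    = trans (ι-⊖ b (suc a)) (+-comm _ _)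
  ι-+ -[1+ a ] -[1+ b ] = begin
    - ιℕ (suc (suc (a ℕ.+ b)))           ≡⟨ ≡.cong (λ n → - ιℕ (suc n)) (ℕ.+-suc a b) ⟨
    - ιℕ (suc a ℕ.+ suc b)               ≈⟨ -‿cong (ιℕ-+ (suc a) (suc b)) ⟩
    - (ιℕ (suc a) + ιℕ (suc b))          ≈⟨ -‿+-comm _ _ ⟨
    - ιℕ (suc a) + - ιℕ (suc b)          ∎

  ι-* : ∀ x y → ι (x ℤ.* y) ≈ ι x * ι y
  ι-* (+ a) (+ b) = trans (ι-cong (ℤ.+◃n≡+n (a ℕ.* b))) (ιℕ-* a b)
  ι-* (+ a) -[1+ b ] = begin
    ι (+ a ℤ.* -[1+ b ])        ≈⟨ ι-cong (ℤ.-◃n≡-n (a ℕ.* suc b)) ⟩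
    ι (ℤ.- + (a ℕ.* suc b))     ≈⟨ ι-neg (+ (a ℕ.* suc b)) ⟩
    - ιℕ (a ℕ.* suc b)          ≈⟨ -‿cong (ιℕ-* a (suc b)) ⟩
    - (ιℕ a * ιℕ (suc b))       ≈⟨ -‿distribʳ-* _ _ ⟩
    ιℕ a * - ιℕ (suc b)         ∎
  ι-* -[1+ a ] (+ b) = begin
    ι (-[1+ a ] ℤ.* + b)        ≈⟨ ι-cong (ℤ.-◃n≡-n (suc a ℕ.* b)) ⟩
    ι (ℤ.- + (suc a ℕ.* b))     ≈⟨ ι-neg (+ (suc a ℕ.* b)) ⟩
    - ιℕ (suc a ℕ.* b)          ≈⟨ -‿cong (ιℕ-* (suc a) b) ⟩
    - (ιℕ (suc a) * ιℕ b)       ≈⟨ -‿distribˡ-* _ _ ⟩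
    - ιℕ (suc a) * ιℕ b         ∎
  ι-* -[1+ a ] -[1+ b ] = begin
    ι (-[1+ a ] ℤ.* -[1+ b ])     ≈⟨ ι-cong (ℤ.+◃n≡+n (suc a ℕ.* suc b)) ⟩
    ιℕ (suc a ℕ.* suc b)          ≈⟨ ιℕ-* (suc a) (suc b) ⟩
    ιℕ (suc a) * ιℕ (suc b)       ≈⟨ -‿involutive _ ⟨
    - - (ιℕ (suc a) * ιℕ (suc b)) ≈⟨ -‿cong (-‿distribˡ-* _ _) ⟩
    - (- ιℕ (suc a) * ιℕ (suc b)) ≈⟨ -‿distribʳ-* _ _ ⟩
    - ιℕ (suc a) * - ιℕ (suc b)   ∎

  ι-sum : ∀ {n} (f : Fin n → ℤ) → ι (ℤMatrices.sum f) ≈ sum (ι ∘ f)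
  ι-sum {zero}  f = ≈-refl
  ι-sum {suc n} f = trans (ι-+ (f zero) _) (+-congˡ (ι-sum (f ∘ suc)))

  embed-⊛ : ∀ {m n p} (A : Mat ℤ m n) (B : Mat ℤ n p) i k →
            ι ((A ℤM.⊛ B) i k) ≈ ((λ i j → ι (A i j)) ⊛ (λ j k → ι (B j k))) i k
  embed-⊛ A B i k = begin
    ι ((A ℤM.⊛ B) i k)                  ≡⟨ ≡.cong ι (ℤM.⊛-sum A B i k) ⟩
    ι (ℤM.sum (λ j → A i j ℤ.* B j k))  ≈⟨ ι-sum (λ j → A i j ℤ.* B j k) ⟩
    sum (λ j → ι (A i j ℤ.* B j k))      ≈⟨ sum-cong-≋ (λ j → ι-* (A i j) (B j k)) ⟩
    sum (λ j → ι (A i j) * ι (B j k))    ≡⟨ ⊛-sum (λ i j → ι (A i j)) (λ j k → ι (B j k)) i k ⟨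
    _                                    ∎

  ι-1M : ∀ {n} (i j : Fin n) → ι (ℤM.1M i j) ≈ 1M i j
  ι-1M i j with i Fin.≟ j
  ... | yes _ = ι-1
  ... | no  _ = ≈-refl

module OverChar0Field {c ℓF} (F : Char0Field c ℓF) where
  open Char0Field F hiding (zero) renaming (refl to ≈-refl)
  open OverField F using (IsDiagonal; IsInverse; Diagonalizes; embed; idM; laplacianW; WGraph; unionW; w)
  open Matrices commutativeRing
  module ℤM = ℤMatrices
  open IntegerEmbedding commutativeRing
  open IntegerMatrices using (HasScaledInverse; Qbase-scaledInverse)
  open import Algebra.Properties.Ring ring using (+-cancelʳ; -0#≈0#)
  open import Relation.Binary.Reasoning.Setoid setoid

  idM≡1M : ∀ {n} (i j : Fin n) → idM i j ≡ 1M i j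
  idM≡1M i j with i Fin.≟ j
  ... | yes _ = refl
  ... | no  _ = refl

  IsInverseOf⇒IsInverse : ∀ {n} {A B : Mat Carrier n n} → B IsInverseOf A → IsInverse A B
  IsInverseOf⇒IsInverse (BA≈1 , AB≈1) = (λ i j → trans (BA≈1 i j) (reflexive (≡.sym (idM≡1M i j))))
                          , (λ i j → trans (AB≈1 i j) (reflexive (≡.sym (idM≡1M i j))))

  IsInverse⇒IsInverseOf : ∀ {n} {A B : Mat Carrier n n} → IsInverse A B → B IsInverseOf A
  IsInverse⇒IsInverseOf (BA≈1 , AB≈1) = (λ i j → trans (BA≈1 i j) (reflexive (idM≡1M i j)))
                            , (λ i j → trans (AB≈1 i j) (reflexive (idM≡1M i j)))

  scaledInverse⇒inverse : ∀ {d} {M : Mat ℤ d d} → HasScaledInverse M → Σ (Mat Carrier d d) (_IsInverseOf embed M)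
  scaledInverse⇒inverse {d} {M} (s , B , BM≈sI , MB≈sI) = s⁻¹ ·M embed B , s⁻¹B-inverse
    where
    s⁻¹ : Carrier
    s⁻¹ = proj₁ (inverse (ιℕ (suc s)) (char0 s))
    s⁻¹-cancel : ∀ x → s⁻¹ * ι (+ suc s ℤ.* x) ≈ ι x
    s⁻¹-cancel x = begin
      s⁻¹ * ι (+ suc s ℤ.* x)       ≈⟨ *-congˡ (ι-* (+ suc s) x) ⟩
      s⁻¹ * (ιℕ (suc s) * ι x)      ≈⟨ *-assoc _ _ _ ⟨
      (s⁻¹ * ιℕ (suc s)) * ι x      ≈⟨ *-congʳ (trans (*-comm _ _) (proj₂ (inverse (ιℕ (suc s)) (char0 s)))) ⟩
      1# * ι x                      ≈⟨ *-identityˡ (ι x) ⟩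
      ι x                           ∎
    embed-scaled : ∀ (A C : Mat ℤ d d) → A ℤM.⊛ C ℤM.≈M (+ suc s) ℤM.·M ℤM.1M → s⁻¹ ·M (embed A ⊛ embed C) ≈M 1M
    embed-scaled A C AC≈sI i j = begin
      s⁻¹ * (embed A ⊛ embed C) i j      ≈⟨ *-congˡ (embed-⊛ A C i j) ⟨
      s⁻¹ * ι ((A ℤM.⊛ C) i j)           ≡⟨ ≡.cong (λ x → s⁻¹ * ι x) (AC≈sI i j) ⟩
      s⁻¹ * ι (+ suc s ℤ.* ℤM.1M i j)    ≈⟨ s⁻¹-cancel (ℤM.1M i j) ⟩
      ι (ℤM.1M i j)                      ≈⟨ ι-1M i j ⟩
      1M i j                             ∎
    s⁻¹B-inverse : (s⁻¹ ·M embed B) IsInverseOf embed M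
    s⁻¹B-inverse = (λ i j → trans (·M-⊛ s⁻¹ (embed B) (embed M) i j) (embed-scaled B M BM≈sI i j))
                 , (λ i j → trans (⊛-·M s⁻¹ (embed M) (embed B) i j) (embed-scaled M B MB≈sI i j))

  Qbase-inverse : ∀ ℓ → 1 ≤ ℓ → Σ (Mat Carrier (2 ^ ℓ) (2 ^ ℓ)) (_IsInverseOf embed (Qbase ℓ))
  Qbase-inverse ℓ 1≤ℓ = scaledInverse⇒inverse (Qbase-scaledInverse ℓ 1≤ℓ)

  EigenColumns : ∀ {n} → Mat Carrier n n → Mat Carrier n n → (Fin n → Carrier) → Set ℓF
  EigenColumns L P λ′ = ∀ i j → (L ⊛ P) i j ≈ P i j * λ′ j

  diagonalizes⇒eigenColumns : ∀ {n} {P L : Mat Carrier n n} (D : Diagonalizes P L) →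
                               EigenColumns L P (λ j → ((proj₁ D ⊛ L) ⊛ P) j j)
  diagonalizes⇒eigenColumns {P = P} {L} (Pinv , inv , diagonal) i j = begin
    (L ⊛ P) i j                     ≈⟨ ⊛-congʳ P (⊛-identityˡ L) i j ⟨
    ((1M ⊛ L) ⊛ P) i j              ≈⟨ ⊛-congʳ P (⊛-congʳ L (proj₂ (IsInverse⇒IsInverseOf inv))) i j ⟨
    (((P ⊛ Pinv) ⊛ L) ⊛ P) i j      ≈⟨ ⊛-congʳ P (⊛-assoc P Pinv L) i j ⟩
    ((P ⊛ (Pinv ⊛ L)) ⊛ P) i j      ≈⟨ ⊛-assoc P (Pinv ⊛ L) P i j ⟩
    (P ⊛ D) i j                     ≡⟨ ⊛-sum P D i j ⟩
    sum (λ k → P i k * D k j)       ≈⟨ sum-single j _ (λ k k≢j → trans (*-congˡ (diagonal k j k≢j)) (zeroʳ (P i k))) ⟩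
    P i j * D j j                   ∎
    where
    D : Mat Carrier _ _
    D = (Pinv ⊛ L) ⊛ P

  eigenColumns⇒diagonal : ∀ {n} {P Pinv L : Mat Carrier n n} {λ′ : Fin n → Carrier} →
                          Pinv ⊛ P ≈M 1M → EigenColumns L P λ′ → IsDiagonal ((Pinv ⊛ L) ⊛ P)
  eigenColumns⇒diagonal {P = P} {Pinv} {L} {λ′} PinvP≈1 eigen i j i≢j = begin
    ((Pinv ⊛ L) ⊛ P) i j                        ≈⟨ ⊛-assoc Pinv L P i j ⟩
    (Pinv ⊛ (L ⊛ P)) i j                        ≡⟨ ⊛-sum Pinv (L ⊛ P) i j ⟩
    sum (λ k → Pinv i k * (L ⊛ P) k j)          ≈⟨ sum-cong-≋ (λ k → trans (*-congˡ (eigen k j)) (sym (*-assoc _ _ _))) ⟩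
    sum (λ k → (Pinv i k * P k j) * λ′ j)        ≈⟨ *-distribʳ-sum (λ′ j) (λ k → Pinv i k * P k j) ⟨
    sum (λ k → Pinv i k * P k j) * λ′ j          ≡⟨ ≡.cong (_* λ′ j) (⊛-sum Pinv P i j) ⟨
    (Pinv ⊛ P) i j * λ′ j                        ≈⟨ *-congʳ (trans (PinvP≈1 i j) (1M-offDiag i≢j)) ⟩
    0# * λ′ j                                    ≈⟨ zeroˡ (λ′ j) ⟩
    0#                                          ∎

  laplacianW-diag : ∀ {m} (W : Mat Carrier m m) i → laplacianW W i i ≈ sum (W i)
  laplacianW-diag W i with i Fin.≟ i
  ... | yes _   = reflexive (sumWith≡foldr _+_ 0# (W i))
  ... | no  i≢i = ⊥-elim (i≢i refl)

  laplacianW-offDiag : ∀ {m} (W : Mat Carrier m m) {i j} → i ≢ j → laplacianW W i j ≈ - W i j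
  laplacianW-offDiag W {i} {j} i≢j with i Fin.≟ j
  ... | yes i≡j = ⊥-elim (i≢j i≡j)
  ... | no  _   = ≈-refl

  laplacianW-cong : ∀ {m} {W W′ : Mat Carrier m m} → W ≈M W′ → laplacianW W ≈M laplacianW W′
  laplacianW-cong {W = W} {W′} W≈W′ i j = byCases (i Fin.≟ j)
    where
    byCases : Dec (i ≡ j) → laplacianW W i j ≈ laplacianW W′ i j
    byCases (yes refl) = trans (laplacianW-diag W i) (trans (sum-cong-≋ (W≈W′ i)) (sym (laplacianW-diag W′ i)))
    byCases (no  i≢j)  = trans (laplacianW-offDiag W i≢j) (trans (-‿cong (W≈W′ i j)) (sym (laplacianW-offDiag W′ i≢j)))

  laplacianW-rowSum : ∀ {m} (W : Mat Carrier m m) i → W i i ≈ 0# → sum (laplacianW W i) ≈ 0#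
  laplacianW-rowSum W i Wii≈0 = trans (+-cancelʳ (sum (W i)) _ _ (begin
    sum (laplacianW W i) + sum (W i)        ≈⟨ ∑-distrib-+ (laplacianW W i) (W i) ⟨
    sum (λ j → laplacianW W i j + W i j)    ≈⟨ sum-single i _ (λ j j≢i → trans (+-congʳ (laplacianW-offDiag W (j≢i ∘ ≡.sym))) (-‿inverseˡ (W i j))) ⟩
    laplacianW W i i + W i i                ≈⟨ +-comm _ _ ⟩
    W i i + laplacianW W i i                ≈⟨ +-congˡ (laplacianW-diag W i) ⟩
    W i i + sum (W i)                       ∎)) Wii≈0

  laplacianW-blockDiagonal : ∀ {k m} (Ws : Fin k → Mat Carrier m m) →
                             laplacianW (blockDiagonal 0# Ws) ≈M blockDiagonal 0# (λ j → laplacianW (Ws j))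
  laplacianW-blockDiagonal {k} {m} Ws p q with blockOf k m p | blockOf k m q
  ... | block j a | block j′ b with j Fin.≟ j′ | a Fin.≟ b
  ...   | yes refl | yes refl = begin
    laplacianW W (combine j a) (combine j a)          ≈⟨ laplacianW-diag W (combine j a) ⟩
    sum (W (combine j a))                             ≈⟨ sum-block j _ (λ j″ b j″≢j → reflexive (blockDiagonal-≢ 0# Ws (j″≢j ∘ ≡.sym) a b)) ⟩
    sum (λ b → W (combine j a) (combine j b))         ≈⟨ sum-cong-≋ (λ b → reflexive (blockDiagonal-≡ 0# Ws j a b)) ⟩
    sum (Ws j a)                                      ≈⟨ laplacianW-diag (Ws j) a ⟨
    laplacianW (Ws j) a a                             ≡⟨ blockDiagonal-≡ 0# (λ j → laplacianW (Ws j)) j a a ⟨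
    blockDiagonal 0# (λ j → laplacianW (Ws j)) (combine j a) (combine j a) ∎
    where W = blockDiagonal 0# Ws
  ...   | yes refl | no a≢b = begin
    laplacianW W (combine j a) (combine j b)          ≈⟨ laplacianW-offDiag W (a≢b ∘ proj₂ ∘ Fin.combine-injective j a j b) ⟩
    - W (combine j a) (combine j b)                   ≡⟨ ≡.cong -_ (blockDiagonal-≡ 0# Ws j a b) ⟩
    - Ws j a b                                        ≈⟨ laplacianW-offDiag (Ws j) a≢b ⟨
    laplacianW (Ws j) a b                             ≡⟨ blockDiagonal-≡ 0# (λ j → laplacianW (Ws j)) j a b ⟨
    blockDiagonal 0# (λ j → laplacianW (Ws j)) (combine j a) (combine j b) ∎
    where W = blockDiagonal 0# Ws
  ...   | no j≢j′ | _ = begin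
    laplacianW W (combine j a) (combine j′ b)         ≈⟨ laplacianW-offDiag W (j≢j′ ∘ proj₁ ∘ Fin.combine-injective j a j′ b) ⟩
    - W (combine j a) (combine j′ b)                  ≡⟨ ≡.cong -_ (blockDiagonal-≢ 0# Ws j≢j′ a b) ⟩
    - 0#                                              ≈⟨ -0#≈0# ⟩
    0#                                                ≡⟨ blockDiagonal-≢ 0# (λ j → laplacianW (Ws j)) j≢j′ a b ⟨
    blockDiagonal 0# (λ j → laplacianW (Ws j)) (combine j a) (combine j′ b) ∎
    where W = blockDiagonal 0# Ws

  unionW≡blockDiagonal : ∀ {k m} (Xs : Fin k → WGraph m) p q → unionW Xs p q ≡ blockDiagonal 0# (w ∘ Xs) p q
  unionW≡blockDiagonal {k} {m} Xs p q with Fin.quotRem {k} m p | Fin.quotRem {k} m q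
  ... | _ , j | _ , j′ with j Fin.≟ j′
  ...   | yes _ = refl
  ...   | no  _ = refl

-- The disjoint union

module DisjointUnion {c ℓF} (F : Char0Field c ℓF) (ℓ : ℕ) (1≤ℓ : 1 ≤ ℓ) (n : ℕ)
  (Xs : Fin (2 ^ ℓ) → OverField.WGraph F (suc n)) (S : Fin (2 ^ ℓ) → Mat ℤ (suc n) (suc n))
  (S-firstColumn : ∀ j a → S j a zero ≡ 1ℤ)
  (S-diagonalizes : ∀ j → OverField.Diagonalizes F (OverField.embed F (S j)) (OverField.laplacian F (Xs j)))
  where

  open Char0Field F hiding (zero) renaming (refl to ≈-refl)
  open OverField F using (Diagonalizes; embed; laplacianW; laplacian; unionW; w; loopless)
  open OverChar0Field F
  open Matrices commutativeRing
  open IntegerEmbedding commutativeRing using (ι-cong; ι-1)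
  open import Algebra.Properties.CommutativeSemigroup *-commutativeSemigroup using (xy∙z≈xz∙y)
  open BigT ℓ n S using (k; m; T; qCol; sCol; qcol; scol; columnOf; byColumn; byColumn-qCol; byColumn-sCol;
                         qCol-injective; sCol-injective; qCol≢sCol; T-qCol; T-sCol-≡; T-sCol-≢)
  open import Relation.Binary.Reasoning.Setoid setoid

  Q : Mat Carrier k k
  Q = embed (Qbase ℓ)

  Qinv : Mat Carrier k k
  Qinv = proj₁ (Qbase-inverse ℓ 1≤ℓ)

  Qinv-inverse : Qinv IsInverseOf Q
  Qinv-inverse = proj₂ (Qbase-inverse ℓ 1≤ℓ)

  ES L Sinv : Fin k → Mat Carrier m m
  ES j   = embed (S j)
  L j    = laplacian (Xs j)
  Sinv j = proj₁ (S-diagonalizes j)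

  Sinv-inverse : ∀ j → Sinv j IsInverseOf ES j
  Sinv-inverse j = IsInverse⇒IsInverseOf {A = ES j} {Sinv j} (proj₁ (proj₂ (S-diagonalizes j)))

  TF : Mat Carrier (k ℕ.* m) (k ℕ.* m)
  TF = embed T

  -- The rows of T⁻¹ belonging to the columns of Q ⊗ 1ₘ combine Q⁻¹ with the first rows of the Sⱼ⁻¹.
  Q-row : Fin k → Fin (k ℕ.* m) → Carrier
  Q-row c p = let (j , a) = remQuot {k} m p in Qinv c j * Sinv j zero a

  S-row : Fin k → Fin n → Fin (k ℕ.* m) → Carrier
  S-row j b = blockDiagonal 0# (λ j → Sinv j ∘ suc) (combine j b)

  Tinv : Mat Carrier (k ℕ.* m) (k ℕ.* m)
  Tinv = byColumn Q-row S-row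

  Tinv-qCol : ∀ c j a → Tinv (qCol c) (combine j a) ≈ Qinv c j * Sinv j zero a
  Tinv-qCol c j a = reflexive (≡.trans (≡.cong-app (byColumn-qCol Q-row S-row c) (combine j a))
                                       (≡.cong (λ (j , a) → Qinv c j * Sinv j zero a) (Fin.remQuot-combine {k} {m} j a)))

  Tinv-sCol-≡ : ∀ j b a → Tinv (sCol j b) (combine j a) ≈ Sinv j (suc b) a
  Tinv-sCol-≡ j b a = reflexive (≡.trans (≡.cong-app (byColumn-sCol Q-row S-row j b) (combine j a))
                                         (blockDiagonal-≡ 0# (λ j → Sinv j ∘ suc) j b a))

  Tinv-sCol-≢ : ∀ {j j′} → j ≢ j′ → ∀ b a → Tinv (sCol j b) (combine j′ a) ≈ 0#
  Tinv-sCol-≢ {j} {j′} j≢j′ b a = reflexive (≡.trans (≡.cong-app (byColumn-sCol Q-row S-row j b) (combine j′ a))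
                                                    (blockDiagonal-≢ 0# (λ j → Sinv j ∘ suc) j≢j′ b a))

  TF-qCol : ∀ j a c → TF (combine j a) (qCol c) ≈ Q j c
  TF-qCol j a c = ι-cong (T-qCol j a c)

  TF-sCol-≡ : ∀ j a b → TF (combine j a) (sCol j b) ≈ ES j a (suc b)
  TF-sCol-≡ j a b = ι-cong (T-sCol-≡ j a b)

  TF-sCol-≢ : ∀ {j j′} → j ≢ j′ → ∀ a b → TF (combine j a) (sCol j′ b) ≈ 0#
  TF-sCol-≢ j≢j′ a b = ι-cong (T-sCol-≢ j≢j′ a b)

  ES-firstColumn : ∀ j a → ES j a zero ≈ 1#
  ES-firstColumn j a = trans (ι-cong (S-firstColumn j a)) ι-1

  private
    Sinv⊛ES-offDiag : ∀ j {b b′} → b ≢ b′ → (Sinv j ⊛ ES j) b b′ ≈ 0#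
    Sinv⊛ES-offDiag j b≢b′ = trans (proj₁ (Sinv-inverse j) _ _) (1M-offDiag b≢b′)

    *-ES-firstColumn : ∀ j a x → x * ES j a zero ≈ x
    *-ES-firstColumn j a x = trans (*-congˡ (ES-firstColumn j a)) (*-identityʳ x)

    Sinv-firstRow-sum : ∀ j → sum (Sinv j zero) ≈ 1#
    Sinv-firstRow-sum j = begin
      sum (Sinv j zero)                         ≈⟨ sum-cong-≋ (λ a → *-ES-firstColumn j a (Sinv j zero a)) ⟨
      sum (λ a → Sinv j zero a * ES j a zero)   ≡⟨ ⊛-sum (Sinv j) (ES j) zero zero ⟨
      (Sinv j ⊛ ES j) zero zero                 ≈⟨ proj₁ (Sinv-inverse j) zero zero ⟩
      1M {m} zero zero                          ≈⟨ 1M-diag {m} zero ⟩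
      1#                                        ∎

    leftInverse-qq : ∀ c d → (Tinv ⊛ TF) (qCol c) (qCol d) ≈ 1M c d
    leftInverse-qq c d = begin
      (Tinv ⊛ TF) (qCol c) (qCol d)    ≈⟨ ⊛-blocks {k = k} {m = m} Tinv TF (qCol c) (qCol d) ⟩
      _                                ≈⟨ sum-cong-≋ blockSum ⟩
      sum (λ j → Qinv c j * Q j d)     ≡⟨ ⊛-sum Qinv Q c d ⟨
      (Qinv ⊛ Q) c d                   ≈⟨ proj₁ Qinv-inverse c d ⟩
      1M c d                           ∎
      where
      blockSum : ∀ j → sum (λ a → Tinv (qCol c) (combine j a) * TF (combine j a) (qCol d)) ≈ Qinv c j * Q j d
      blockSum j = begin
        _                                                ≈⟨ sum-cong-≋ (λ a → *-cong (Tinv-qCol c j a) (TF-qCol j a d)) ⟩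
        sum (λ a → (Qinv c j * Sinv j zero a) * Q j d)   ≈⟨ sum-cong-≋ (λ a → xy∙z≈xz∙y (Qinv c j) (Sinv j zero a) (Q j d)) ⟩
        sum (λ a → (Qinv c j * Q j d) * Sinv j zero a)   ≈⟨ *-distribˡ-sum (Qinv c j * Q j d) (Sinv j zero) ⟨
        (Qinv c j * Q j d) * sum (Sinv j zero)           ≈⟨ *-congˡ (Sinv-firstRow-sum j) ⟩
        (Qinv c j * Q j d) * 1#                          ≈⟨ *-identityʳ _ ⟩
        Qinv c j * Q j d                                 ∎

    leftInverse-qs : ∀ c j b → (Tinv ⊛ TF) (qCol c) (sCol j b) ≈ 0#
    leftInverse-qs c j b = begin
      (Tinv ⊛ TF) (qCol c) (sCol j b)                              ≈⟨ ⊛-block {k = k} {m = m} Tinv TF j _ _ off ⟩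
      _                                                            ≈⟨ sum-cong-≋ (λ a → *-cong (Tinv-qCol c j a) (TF-sCol-≡ j a b)) ⟩
      sum (λ a → (Qinv c j * Sinv j zero a) * ES j a (suc b))      ≈⟨ sum-cong-≋ (λ a → *-assoc (Qinv c j) (Sinv j zero a) (ES j a (suc b))) ⟩
      sum (λ a → Qinv c j * (Sinv j zero a * ES j a (suc b)))      ≈⟨ *-distribˡ-sum (Qinv c j) (λ a → Sinv j zero a * ES j a (suc b)) ⟨
      Qinv c j * sum (λ a → Sinv j zero a * ES j a (suc b))        ≡⟨ ≡.cong (Qinv c j *_) (⊛-sum (Sinv j) (ES j) zero (suc b)) ⟨
      Qinv c j * (Sinv j ⊛ ES j) zero (suc b)                      ≈⟨ *-congˡ (Sinv⊛ES-offDiag j {zero} {suc b} λ ()) ⟩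
      Qinv c j * 0#                                                ≈⟨ zeroʳ (Qinv c j) ⟩
      0#                                                           ∎
      where
      off : ∀ j′ a → j′ ≢ j → Tinv (qCol c) (combine j′ a) * TF (combine j′ a) (sCol j b) ≈ 0#
      off j′ a j′≢j = trans (*-congˡ (TF-sCol-≢ j′≢j a b)) (zeroʳ (Tinv (qCol c) (combine j′ a)))

    leftInverse-sq : ∀ j b d → (Tinv ⊛ TF) (sCol j b) (qCol d) ≈ 0#
    leftInverse-sq j b d = begin
      (Tinv ⊛ TF) (sCol j b) (qCol d)                              ≈⟨ ⊛-block {k = k} {m = m} Tinv TF j _ _ off ⟩
      _                                                            ≈⟨ sum-cong-≋ (λ a → *-cong (Tinv-sCol-≡ j b a) (TF-qCol j a d)) ⟩
      sum (λ a → Sinv j (suc b) a * Q j d)                         ≈⟨ sum-cong-≋ (λ a → *-congʳ {Q j d} (*-ES-firstColumn j a (Sinv j (suc b) a))) ⟨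
      sum (λ a → (Sinv j (suc b) a * ES j a zero) * Q j d)         ≈⟨ *-distribʳ-sum (Q j d) (λ a → Sinv j (suc b) a * ES j a zero) ⟨
      sum (λ a → Sinv j (suc b) a * ES j a zero) * Q j d           ≡⟨ ≡.cong (_* Q j d) (⊛-sum (Sinv j) (ES j) (suc b) zero) ⟨
      (Sinv j ⊛ ES j) (suc b) zero * Q j d                         ≈⟨ *-congʳ (Sinv⊛ES-offDiag j {suc b} {zero} λ ()) ⟩
      0# * Q j d                                                   ≈⟨ zeroˡ (Q j d) ⟩
      0#                                                           ∎
      where
      off : ∀ j′ a → j′ ≢ j → Tinv (sCol j b) (combine j′ a) * TF (combine j′ a) (qCol d) ≈ 0#
      off j′ a j′≢j = trans (*-congʳ (Tinv-sCol-≢ (j′≢j ∘ ≡.sym) b a)) (zeroˡ (TF (combine j′ a) (qCol d)))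

    leftInverse-ss : ∀ j b j′ b′ → (Tinv ⊛ TF) (sCol j b) (sCol j′ b′) ≈ 1M (sCol j b) (sCol j′ b′)
    leftInverse-ss j b j′ b′ = trans (⊛-block {k = k} {m = m} Tinv TF j _ _ off) (byCases (j Fin.≟ j′))
      where
      off : ∀ j″ a → j″ ≢ j → Tinv (sCol j b) (combine j″ a) * TF (combine j″ a) (sCol j′ b′) ≈ 0#
      off j″ a j″≢j = trans (*-congʳ (Tinv-sCol-≢ (j″≢j ∘ ≡.sym) b a)) (zeroˡ (TF (combine j″ a) (sCol j′ b′)))
      byCases : Dec (j ≡ j′) → sum (λ a → Tinv (sCol j b) (combine j a) * TF (combine j a) (sCol j′ b′)) ≈ 1M (sCol j b) (sCol j′ b′)
      byCases (yes refl) = begin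
        _                                                    ≈⟨ sum-cong-≋ (λ a → *-cong (Tinv-sCol-≡ j b a) (TF-sCol-≡ j a b′)) ⟩
        sum (λ a → Sinv j (suc b) a * ES j a (suc b′))       ≡⟨ ⊛-sum (Sinv j) (ES j) (suc b) (suc b′) ⟨
        (Sinv j ⊛ ES j) (suc b) (suc b′)                     ≈⟨ proj₁ (Sinv-inverse j) (suc b) (suc b′) ⟩
        1M (suc b) (suc b′)                                  ≈⟨ 1M-reindex suc Fin.suc-injective b b′ ⟩
        1M b b′                                              ≈⟨ 1M-reindex (sCol j) (proj₂ ∘ sCol-injective) b b′ ⟨
        1M (sCol j b) (sCol j b′)                            ∎
      byCases (no j≢j′) = trans (sum-zero (λ a → trans (*-congˡ (TF-sCol-≢ j≢j′ a b′)) (zeroʳ (Tinv (sCol j b) (combine j a)))))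
                                (sym (1M-offDiag (j≢j′ ∘ proj₁ ∘ sCol-injective)))

  Tinv-leftInverse : Tinv ⊛ TF ≈M 1M
  Tinv-leftInverse x y with columnOf x | columnOf y
  ... | qcol c   | qcol d     = trans (leftInverse-qq c d) (sym (1M-reindex qCol qCol-injective c d))
  ... | qcol c   | scol j b   = trans (leftInverse-qs c j b) (sym (1M-offDiag qCol≢sCol))
  ... | scol j b | qcol d     = trans (leftInverse-sq j b d) (sym (1M-offDiag (qCol≢sCol ∘ ≡.sym)))
  ... | scol j b | scol j′ b′ = leftInverse-ss j b j′ b′

  private
    rightInverse-blocks : ∀ j a j′ a′ → (TF ⊛ Tinv) (combine j a) (combine j′ a′) ≈
                          1M j j′ * Sinv j′ zero a′ + sum (λ b → ES j a (suc b) * Tinv (sCol j b) (combine j′ a′))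
    rightInverse-blocks j a j′ a′ = begin
      (TF ⊛ Tinv) p p′                                                      ≡⟨ ⊛-sum TF Tinv p p′ ⟩
      sum (λ y → TF p y * Tinv y p′)                                        ≈⟨ sum-columns k n (λ y → TF p y * Tinv y p′) ⟩
      sum (λ c → TF p (qCol c) * Tinv (qCol c) p′) + sum (λ j″ → sum (λ b → TF p (sCol j″ b) * Tinv (sCol j″ b) p′))
                                                                            ≈⟨ +-cong Q-part S-part ⟩
      1M j j′ * Sinv j′ zero a′ + sum (λ b → ES j a (suc b) * Tinv (sCol j b) p′) ∎
      where
      p p′ : Fin (k ℕ.* m)
      p  = combine j a
      p′ = combine j′ a′
      Q-part : sum (λ c → TF p (qCol c) * Tinv (qCol c) p′) ≈ 1M j j′ * Sinv j′ zero a′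
      Q-part = begin
        _                                                 ≈⟨ sum-cong-≋ (λ c → *-cong (TF-qCol j a c) (Tinv-qCol c j′ a′)) ⟩
        sum (λ c → Q j c * (Qinv c j′ * Sinv j′ zero a′))  ≈⟨ sum-cong-≋ (λ c → *-assoc (Q j c) (Qinv c j′) (Sinv j′ zero a′)) ⟨
        sum (λ c → (Q j c * Qinv c j′) * Sinv j′ zero a′)  ≈⟨ *-distribʳ-sum (Sinv j′ zero a′) (λ c → Q j c * Qinv c j′) ⟨
        sum (λ c → Q j c * Qinv c j′) * Sinv j′ zero a′    ≡⟨ ≡.cong (_* Sinv j′ zero a′) (⊛-sum Q Qinv j j′) ⟨
        (Q ⊛ Qinv) j j′ * Sinv j′ zero a′                  ≈⟨ *-congʳ (proj₂ Qinv-inverse j j′) ⟩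
        1M j j′ * Sinv j′ zero a′                          ∎
      S-part : sum (λ j″ → sum (λ b → TF p (sCol j″ b) * Tinv (sCol j″ b) p′)) ≈ sum (λ b → ES j a (suc b) * Tinv (sCol j b) p′)
      S-part = trans (sum-single j _ (λ j″ j″≢j → sum-zero (λ b → trans (*-congʳ (TF-sCol-≢ (j″≢j ∘ ≡.sym) a b)) (zeroˡ _))))
                     (sum-cong-≋ (λ b → *-congʳ (TF-sCol-≡ j a b)))

    rightInverse-≡ : ∀ j a a′ → (TF ⊛ Tinv) (combine j a) (combine j a′) ≈ 1M a a′
    rightInverse-≡ j a a′ = begin
      (TF ⊛ Tinv) (combine j a) (combine j a′)                                     ≈⟨ rightInverse-blocks j a j a′ ⟩
      1M j j * Sinv j zero a′ + sum (λ b → ES j a (suc b) * Tinv (sCol j b) (combine j a′))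
                                                                                   ≈⟨ +-cong first rest ⟩
      ES j a zero * Sinv j zero a′ + sum (λ b → ES j a (suc b) * Sinv j (suc b) a′) ≡⟨ ⊛-sum (ES j) (Sinv j) a a′ ⟨
      (ES j ⊛ Sinv j) a a′                                                         ≈⟨ proj₂ (Sinv-inverse j) a a′ ⟩
      1M a a′                                                                      ∎
      where
      first : 1M j j * Sinv j zero a′ ≈ ES j a zero * Sinv j zero a′
      first = *-congʳ (trans (1M-diag j) (sym (ES-firstColumn j a)))
      rest : sum (λ b → ES j a (suc b) * Tinv (sCol j b) (combine j a′)) ≈ sum (λ b → ES j a (suc b) * Sinv j (suc b) a′)
      rest = sum-cong-≋ (λ b → *-congˡ (Tinv-sCol-≡ j b a′))

    rightInverse-≢ : ∀ {j j′} → j ≢ j′ → ∀ a a′ → (TF ⊛ Tinv) (combine j a) (combine j′ a′) ≈ 0#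
    rightInverse-≢ {j} {j′} j≢j′ a a′ = begin
      (TF ⊛ Tinv) (combine j a) (combine j′ a′)                                     ≈⟨ rightInverse-blocks j a j′ a′ ⟩
      1M j j′ * Sinv j′ zero a′ + sum (λ b → ES j a (suc b) * Tinv (sCol j b) (combine j′ a′))
                                                                                    ≈⟨ +-cong first rest ⟩
      0# + 0#                                                                       ≈⟨ +-identityʳ 0# ⟩
      0#                                                                            ∎
      where
      first : 1M j j′ * Sinv j′ zero a′ ≈ 0#
      first = trans (*-congʳ (1M-offDiag j≢j′)) (zeroˡ _)
      rest : sum (λ b → ES j a (suc b) * Tinv (sCol j b) (combine j′ a′)) ≈ 0#
      rest = sum-zero (λ b → trans (*-congˡ (Tinv-sCol-≢ j≢j′ b a′)) (zeroʳ _))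

  Tinv-rightInverse : TF ⊛ Tinv ≈M 1M
  Tinv-rightInverse p p′ with blockOf k m p | blockOf k m p′
  ... | block j a | block j′ a′ with j Fin.≟ j′
  ...   | yes refl = trans (rightInverse-≡ j a a′) (sym (1M-reindex (combine j) (proj₂ ∘ Fin.combine-injective j _ j _) a a′))
  ...   | no  j≢j′ = trans (rightInverse-≢ j≢j′ a a′) (sym (1M-offDiag (j≢j′ ∘ proj₁ ∘ Fin.combine-injective j a j′ a′)))

  LU : Mat Carrier (k ℕ.* m) (k ℕ.* m)
  LU = laplacianW (unionW Xs)

  LU≈blockDiagonal : LU ≈M blockDiagonal 0# L
  LU≈blockDiagonal p q = trans (laplacianW-cong (λ p q → reflexive (unionW≡blockDiagonal Xs p q)) p q)
                               (laplacianW-blockDiagonal (w ∘ Xs) p q)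

  D : Fin k → Mat Carrier m m
  D j = (Sinv j ⊛ L j) ⊛ ES j

  eigenvalue : Fin (k ℕ.* m) → Carrier
  eigenvalue = byColumn (λ _ → 0#) (λ j b → D j (suc b) (suc b))

  private
    eigenvalue-qCol : ∀ c → eigenvalue (qCol c) ≡ 0#
    eigenvalue-qCol = byColumn-qCol (λ _ → 0#) (λ j b → D j (suc b) (suc b))

    eigenvalue-sCol : ∀ j b → eigenvalue (sCol j b) ≡ D j (suc b) (suc b)
    eigenvalue-sCol = byColumn-sCol (λ _ → 0#) (λ j b → D j (suc b) (suc b))

    LU⊛TF-blocks : ∀ j a y → (LU ⊛ TF) (combine j a) y ≈ sum (λ b → L j a b * TF (combine j b) y)
    LU⊛TF-blocks j a y = trans (⊛-congʳ TF LU≈blockDiagonal (combine j a) y) (blockDiagonal-⊛ L TF j a y)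

  T-eigenColumns : EigenColumns LU TF eigenvalue
  T-eigenColumns p y with blockOf k m p | columnOf y
  ... | block j a | qcol c = begin
    (LU ⊛ TF) (combine j a) (qCol c)                  ≈⟨ LU⊛TF-blocks j a (qCol c) ⟩
    sum (λ b → L j a b * TF (combine j b) (qCol c))   ≈⟨ sum-cong-≋ (λ b → *-congˡ {L j a b} (TF-qCol j b c)) ⟩
    sum (λ b → L j a b * Q j c)                       ≈⟨ *-distribʳ-sum (Q j c) (L j a) ⟨
    sum (L j a) * Q j c                               ≈⟨ *-congʳ (laplacianW-rowSum (w (Xs j)) a (loopless (Xs j) a)) ⟩
    0# * Q j c                                        ≈⟨ zeroˡ (Q j c) ⟩
    0#                                                ≈⟨ zeroʳ _ ⟨
    TF (combine j a) (qCol c) * 0#                    ≡⟨ ≡.cong (TF (combine j a) (qCol c) *_) (eigenvalue-qCol c) ⟨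
    TF (combine j a) (qCol c) * eigenvalue (qCol c)   ∎
  ... | block j a | scol j′ b = trans (LU⊛TF-blocks j a (sCol j′ b))
    (trans (byCases (j Fin.≟ j′)) (*-congˡ (reflexive (≡.sym (eigenvalue-sCol j′ b)))))
    where
    byCases : Dec (j ≡ j′) → sum (λ b′ → L j a b′ * TF (combine j b′) (sCol j′ b)) ≈
                             TF (combine j a) (sCol j′ b) * D j′ (suc b) (suc b)
    byCases (yes refl) = begin
      sum (λ b′ → L j a b′ * TF (combine j b′) (sCol j b))      ≈⟨ sum-cong-≋ (λ b′ → *-congˡ {L j a b′} (TF-sCol-≡ j b′ b)) ⟩
      sum (λ b′ → L j a b′ * ES j b′ (suc b))                   ≡⟨ ⊛-sum (L j) (ES j) a (suc b) ⟨
      (L j ⊛ ES j) a (suc b)                                    ≈⟨ diagonalizes⇒eigenColumns {P = ES j} {L j} (S-diagonalizes j) a (suc b) ⟩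
      ES j a (suc b) * D j (suc b) (suc b)                      ≈⟨ *-congʳ (TF-sCol-≡ j a b) ⟨
      TF (combine j a) (sCol j b) * D j (suc b) (suc b)         ∎
    byCases (no j≢j′) = begin
      sum (λ b′ → L j a b′ * TF (combine j b′) (sCol j′ b))     ≈⟨ sum-zero (λ b′ → trans (*-congˡ (TF-sCol-≢ j≢j′ b′ b)) (zeroʳ (L j a b′))) ⟩
      0#                                                        ≈⟨ zeroˡ _ ⟨
      0# * D j′ (suc b) (suc b)                                 ≈⟨ *-congʳ (TF-sCol-≢ j≢j′ a b) ⟨
      TF (combine j a) (sCol j′ b) * D j′ (suc b) (suc b)       ∎

  T-diagonalizes : Diagonalizes TF LU
  T-diagonalizes = Tinv , IsInverseOf⇒IsInverse (Tinv-leftInverse , Tinv-rightInverse)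
                       , eigenColumns⇒diagonal Tinv-leftInverse T-eigenColumns

corollary3p6 : ∀ {c ℓF} (F : Char0Field c ℓF) (ℓ : ℕ) → 1 ≤ ℓ → (n : ℕ)
    → (Xs : Fin (2 ^ ℓ) → OverField.WGraph F (suc n))
    → (S : Fin (2 ^ ℓ) → Mat ℤ (suc n) (suc n))
    → (∀ j → WeakHadamard (S j))
    → (∀ j → OrthogonalColumns (S j))
    → (∀ j i → S j i zero ≡ 1ℤ)
    → (∀ j col → sumℤ (λ i → S j i (suc col)) ≡ 0ℤ)
    → (∀ j → OverField.Diagonalizes F (OverField.embed F (S j)) (OverField.laplacian F (Xs j)))
    → OverField.WHDLap F (OverField.laplacianW F (OverField.unionW F Xs))
      × OverField.Diagonalizes F (OverField.embed F (bigT ℓ n S)) (OverField.laplacianW F (OverField.unionW F Xs))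
      × WeakHadamard (bigT ℓ n S)
      × OrthogonalColumns (bigT ℓ n S)
corollary3p6 F ℓ 1≤ℓ n Xs S S-weakHadamard S-orthogonal S-firstColumn S-columnSums S-diagonalizes =
  (bigT ℓ n S , weakHadamard , T-diagonalizes) , T-diagonalizes , weakHadamard , orthogonal
  where
  open IntegerMatrices using (orthogonal⇒weakHadamard; Qbase-trits; Qbase-orthogonal)
  open BigT ℓ n S using (T-trits; T-orthogonal)
  open DisjointUnion F ℓ 1≤ℓ n Xs S S-firstColumn S-diagonalizes using (T-diagonalizes)

  orthogonal : OrthogonalColumns (bigT ℓ n S)
  orthogonal = T-orthogonal (Qbase-orthogonal ℓ 1≤ℓ) S-orthogonal
    (λ j b → ≡.trans (≡.sym (sumWith≡foldr ℤ._+_ 0ℤ (λ a → S j a (suc b)))) (S-columnSums j b))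

  weakHadamard : WeakHadamard (bigT ℓ n S)
  weakHadamard = orthogonal⇒weakHadamard (T-trits (Qbase-trits ℓ 1≤ℓ) (λ j → proj₁ (S-weakHadamard j))) orthogonal
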